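{- Let $w\in\widetilde{C}_n/C_n$ with window $w_i=c_iN+\sigma_i$ ($N=2n+2$, $c_i\in\mathbb{Z}$, $\sigma\in C_n$), and let $\lambda\in L_n$ correspond to $w$ under $w\mapsto(2c_1-e_1,\dots,2nc_n-e_n)$, $(e_1,\dots,e_n)=\Psi(\sigma)$. Then \[ \beta(w)=\sum_{i=1}^nc_i=\sum_{i=1}^n\Big\lceil\frac{\lambda_i}{2i}\Big\rceil. \]
   Context: The affine hyperoctahedral group $\widetilde{C}_n$ is the group (under composition) of bijections $w:\mathbb{Z}\to\mathbb{Z}$ with $w(i+N)=w(i)+N$ and $w(-i)=-w(i)$; it is a Coxeter group with generators $s_0,\dots,s_n$, where $s_i$ ($1\le i\le n-1$) exchanges $i$ and $i+1$, $s_0$ exchanges $-1$ and $1$, and $s_n$ exchanges $n$ and $n+2$ (each extended by the two symmetry conditions). Write $w_i=w(i)$; $w$ is determined by its window $[w_1,\dots,w_n]$. $C_n$ is the parabolic subgroup generated by $s_0,\dots,s_{n-1}$ (identified with signed permutations of $\{1,\dots,n\}$), and $\widetilde{C}_n/C_n$ is the set of minimal length coset representatives, exactly the $w$ with $0<w_1<\cdots<w_n$; each has a unique representation $w_i=c_iN+\sigma_i$ with $\sigma_i\in\{\pm1,\dots,\pm n\}$ and $(|\sigma_1|,\dots,|\sigma_n|)$ a permutation. $\beta(w)$ is the number of occurrences of $s_n$ in any reduced word for $w$. $\Psi(\sigma)=(e_1,\dots,e_n)$ where, with $e^*_i=\#\{j<i:|\sigma_j|>|\sigma_i|\}$, $e_i=e^*_i$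 if $\sigma_i>0$ and $e_i=2i-1-e^*_i$ if $\sigma_i<0$. $L_n$ is the set of integer tuples with $0\le\lambda_1/1\le\cdots\le\lambda_n/n$. -}

module Defs where

open import Data.Nat as ℕ using (ℕ; zero; suc)
open import Data.Integer as ℤ using (ℤ; +_; -_; _+_; _-_; _*_; ∣_∣)
open import Data.Integer.DivMod using (_/ℕ_; _%ℕ_)
open import Data.Fin using (Fin; zero; suc; toℕ)
open import Data.Bool using (Bool; true; false; if_then_else_)
open import Data.List using (List; []; _∷_; length)
open import Data.Product using (_×_; ∃-syntax)
open import Function using (_∘_; id)
open import Function.Definitions using (Bijective; Injective)
open import Relation.Binary.PropositionalEquality using (_≡_)

-- Affine signed permutations in C̃ₙ, represented by their window
-- [w₁,…,wₙ]  (window position i, 1 ≤ i ≤ n, is the index  k : Fin n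
-- with  i = toℕ k + 1).

-- The modulus N = 2n+2 (written as a successor so it is NonZero).
Nmod : ℕ → ℕ
Nmod n = suc (suc (2 ℕ.* n))

-- winAt w i = w_i for 1 ≤ i ≤ n (1-based), 0 otherwise (never used).
winAt : ∀ {n} → (Fin n → ℤ) → ℕ → ℤ
winAt {zero}  w _             = + 0
winAt {suc n} w zero          = + 0
winAt {suc n} w (suc zero)    = w zero
winAt {suc n} w (suc (suc j)) = winAt (w ∘ suc) (suc j)

-- The unique extension of a window to a map ℤ → ℤ satisfying
-- w(i+N) = w(i)+N and w(-i) = -w(i)  (hence w(0)=0, w(n+1)=n+1).
-- Write x = qN + r with 0 ≤ r < N.
ext : ∀ {n} → (Fin n → ℤ) → ℤ → ℤ
ext {n} w x =
  let N = Nmod n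
      q = x /ℕ N
      r = x %ℕ N
      base = q * + N
  in if r ℕ.≡ᵇ 0 then base
     else if r ℕ.≤ᵇ n then base + winAt w r
     else if r ℕ.≡ᵇ suc n then base + + (suc n)
     else base + + N - winAt w (N ℕ.∸ r)   -- w(r) = N - w(N-r)

InAffC : ∀ {n} → (Fin n → ℤ) → Set
InAffC w = Bijective _≡_ _≡_ (ext w)

-- Windows of the Coxeter generators s₀,…,sₙ  (index a : Fin (suc n)).
-- p = toℕ j + 1 is the (1-based) window position.
genWin : ∀ {n} → Fin (suc n) → Fin n → ℤ
genWin {n} a j =
  let p = suc (toℕ j)
      i = toℕ a
  in if i ℕ.≡ᵇ 0 then (if p ℕ.≡ᵇ 1 then - (+ 1) else + p)          -- s₀ : -1 ↔ 1
     else if i ℕ.≡ᵇ n then (if p ℕ.≡ᵇ n then + (suc (suc n)) else + p) -- sₙ : n ↔ n+2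
     else if p ℕ.≡ᵇ i then + (suc i)                                 -- sᵢ : i ↔ i+1
     else if p ℕ.≡ᵇ suc i then + i
     else + p

gen : ∀ {n} → Fin (suc n) → ℤ → ℤ
gen a = ext (genWin a)

evalWord : ∀ {n} → List (Fin (suc n)) → ℤ → ℤ
evalWord []       = id
evalWord (a ∷ as) = gen a ∘ evalWord as

Represents : ∀ {n} → List (Fin (suc n)) → (Fin n → ℤ) → Set
Represents {n} ρ w = (j : Fin n) → evalWord ρ (+ suc (toℕ j)) ≡ w j

Reduced : ∀ {n} → List (Fin (suc n)) → (Fin n → ℤ) → Set
Reduced {n} ρ w =
  Represents ρ w × ((ρ' : List (Fin (suc n))) → Represents ρ' w → length ρ ℕ.≤ length ρ')

countSn : ∀ {n} → List (Fin (suc n)) → ℕ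
countSn {n} []       = 0
countSn {n} (a ∷ as) = (if toℕ a ℕ.≡ᵇ n then 1 else 0) ℕ.+ countSn as

-- minimal length coset representative: 0 < w₁ < ⋯ < wₙ
Increasing : ∀ {n} → (Fin n → ℤ) → Set
Increasing {n} w = ((k : Fin n) → toℕ k ≡ 0 → + 0 ℤ.< w k)
                 × ((j k : Fin n) → suc (toℕ j) ≡ toℕ k → w j ℤ.< w k)

sumℤ : ∀ {n} → (Fin n → ℤ) → ℤ
sumℤ {zero}  f = + 0
sumℤ {suc n} f = f zero + sumℤ (f ∘ suc)

countFin : ∀ {n} → (Fin n → Bool) → ℕ
countFin {zero}  p = 0
countFin {suc n} p = (if p zero then 1 else 0) ℕ.+ countFin (p ∘ suc)

-- Ψ(σ) = (e₁,…,eₙ) ; position i = toℕ k + 1.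

eStar : ∀ {n} → (Fin n → ℤ) → Fin n → ℕ
eStar σ k = countFin (λ j → (toℕ j ℕ.<ᵇ toℕ k) Data.Bool.∧ (∣ σ k ∣ ℕ.<ᵇ ∣ σ j ∣))
  where import Data.Bool

isPos : ℤ → Bool
isPos (+ suc _) = true
isPos _         = false

Ψ : ∀ {n} → (Fin n → ℤ) → Fin n → ℤ
Ψ σ k = if isPos (σ k)
        then + eStar σ k
        else + (suc (2 ℕ.* toℕ k)) - + eStar σ k   -- 2i - 1 - e*_i

ceilDiv : ℤ → (d : ℕ) → .{{ℕ.NonZero d}} → ℤ
ceilDiv a d = - ((- a) /ℕ d)

module Submission where

-- Write a window entry as w_i = q N + s with 1 ≤ |s| ≤ n, stored as the pair (q , s) of its
-- level q and residue s. Right multiplication by s₀ negates the first entry, by sₙ replaces the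
-- last entry w by N − w, and by sᵢ swaps entries i and i+1. The statistic ℓ = inversions, a sum
-- of absolute values of floor-like expressions over single entries and pairs of entries, changes
-- by one under every generator, and whenever it grows the level sum Σ|q_i| grows by one for sₙ
-- and stays put for the other generators. Hence every word for w has length at least ℓ(w), and
-- a word of length ℓ(w) contains Σ|q_i| letters sₙ. Conversely every window other than the
-- identity has a generator lowering ℓ, so w has a word of length ℓ(w). Thus the reduced words
-- are those of length ℓ(w), and β(w) = Σ|c_i| = Σ c_i because w_i > 0 forces c_i ≥ 0.
-- Finally 0 ≤ e_i < 2i gives ⌈(2i c_i − e_i)/2i⌉ = c_i.

open import Defs
open import Data.Bool using (Bool; true; false; T; if_then_else_; _∧_)
open import Data.Bool.Properties using (T-≡; ¬-not)
open import Data.Empty using (⊥-elim)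
open import Data.Fin using (Fin; toℕ)
import Data.Fin as Fin
import Data.Fin.Properties as FinP
open import Data.Integer as ℤ using (ℤ; +_; -[1+_]; -_; _+_; _-_; _*_; ∣_∣)
open import Data.Integer.DivMod using (_/ℕ_; _%ℕ_)
import Data.Integer.DivMod as DivMod
import Data.Integer.Properties as ℤP
open import Data.Integer.Tactic.RingSolver using (solve-∀)
open import Data.List using (List; []; _∷_; _++_; length; map; foldl; tabulate)
open import Data.List.Properties using (∷-injectiveˡ; foldl-++; length-++; length-tabulate)
open import Data.List.Relation.Binary.Permutation.Propositional using (_↭_; ↭-refl; ↭-prep; ↭-swap; ↭-sym)
open import Data.List.Relation.Binary.Permutation.Propositional.Properties using (map⁺; ↭-length; All-resp-↭)
open import Data.List.Relation.Unary.All using (All; []; _∷_)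
import Data.List.Relation.Unary.All as All
import Data.List.Relation.Unary.All.Properties as AllP
open import Data.List.Relation.Unary.AllPairs using (AllPairs; []; _∷_)
import Data.List.Relation.Unary.AllPairs.Properties as AllPairsP
open import Data.List.Relation.Unary.Linked using (Linked; []; [-]; _∷_)
open import Data.Nat as ℕ using (ℕ; zero; suc)
open import Data.Nat.ListAction using (sum)
open import Data.Nat.ListAction.Properties using (sum-↭)
import Data.Nat.Properties as ℕP
import Data.Nat.Tactic.RingSolver as ℕSolver
open import Data.Product using (_×_; _,_; proj₁; proj₂; ∃-syntax)
import Data.Product
open import Data.Sum using (_⊎_; inj₁; inj₂)
open import Function using (_∘_)
open import Function.Bundles using (Equivalence)
open import Function.Definitions using (Injective)
open import Relation.Binary.Definitions using (Symmetric; tri<; tri≈; tri>)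
open import Relation.Binary.PropositionalEquality using (_≡_; _≢_; refl; sym; trans; cong; cong₂; subst; subst₂; module ≡-Reasoning)
open import Relation.Nullary using (yes; no)

+-suc-cancel : ∀ a b c → a ℕ.+ suc c ≡ b ℕ.+ c → suc a ≡ b
+-suc-cancel a b c eq = ℕP.+-cancelʳ-≡ c (suc a) b (trans (sym (ℕP.+-suc a c)) eq)

∣t+1∣≡1+∣t∣ : ∀ {t} → + 0 ℤ.≤ t → ∣ t + + 1 ∣ ≡ suc ∣ t ∣
∣t+1∣≡1+∣t∣ {+ n} _ = ℕP.+-comm n 1

∣t∣≡1+∣t+1∣ : ∀ {t} → t ℤ.< + 0 → ∣ t ∣ ≡ suc ∣ t + + 1 ∣
∣t∣≡1+∣t+1∣ { -[1+ zero ]}  _ = refl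
∣t∣≡1+∣t+1∣ { -[1+ suc _ ]} _ = refl
∣t∣≡1+∣t+1∣ {+ _} (ℤ.+<+ ())

∣1-q∣≡1+∣q∣ : ∀ {q} → q ℤ.≤ + 0 → ∣ + 1 - q ∣ ≡ suc ∣ q ∣
∣1-q∣≡1+∣q∣ {+ zero}   _ = refl
∣1-q∣≡1+∣q∣ { -[1+ _ ]} _ = refl
∣1-q∣≡1+∣q∣ {+ suc _}   (ℤ.+≤+ ())

+[m∸k]≡+m-+k : ∀ {m k} → k ℕ.≤ m → + (m ℕ.∸ k) ≡ + m - + k
+[m∸k]≡+m-+k {m} {k} k≤m = sym (trans (ℤP.m-n≡m⊖n m k) (ℤP.⊖-≥ k≤m))

∣a∣≢∣b∣⇒a-b≢0 : ∀ a b → ∣ a ∣ ≢ ∣ b ∣ → a - b ≢ + 0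
∣a∣≢∣b∣⇒a-b≢0 a b a≢b a-b≡0 = a≢b (cong ∣_∣ (ℤP.i-j≡0⇒i≡j a b a-b≡0))

∣a∣≢∣b∣⇒a+b≢0 : ∀ a b → ∣ a ∣ ≢ ∣ b ∣ → a + b ≢ + 0
∣a∣≢∣b∣⇒a+b≢0 a b a≢b a+b≡0 =
  a≢b (trans (cong ∣_∣ (ℤP.i-j≡0⇒i≡j a (- b) (trans (cong (_+_ a) (ℤP.neg-involutive b)) a+b≡0)))
             (ℤP.∣-i∣≡∣i∣ b))

∣-∣-cong-neg : ∀ {t u} → t ≡ - u → ∣ t ∣ ≡ ∣ u ∣
∣-∣-cong-neg {u = u} refl = ℤP.∣-i∣≡∣i∣ u

multiple<⇒0 : ∀ k d δ → ∣ δ ∣ ℕ.< d → k * + d ≡ δ → k ≡ + 0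
multiple<⇒0 k d δ ∣δ∣<d kd≡δ = ℤP.∣i∣≡0⇒i≡0 (ℕP.n<1⇒n≡0 (ℕP.*-cancelʳ-< d ∣ k ∣ 1 ∣k∣d<1d))
  where
  ∣k∣d<1d : ∣ k ∣ ℕ.* d ℕ.< 1 ℕ.* d
  ∣k∣d<1d = subst₂ ℕ._<_ (trans (cong ∣_∣ (sym kd≡δ)) (ℤP.abs-* k (+ d))) (sym (ℕP.*-identityˡ d)) ∣δ∣<d

euclid-unique : ∀ d q q′ r r′ → ∣ r′ - r ∣ ℕ.< d → q * + d + r ≡ q′ * + d + r′ → q ≡ q′ × r ≡ r′
euclid-unique d q q′ r r′ ∣r′-r∣<d e = q≡q′ , r≡r′
  where
  difference : (q - q′) * + d ≡ r′ - r
  difference = trans (expand q q′ r (+ d)) (trans (cong (λ t → t - r - q′ * + d) e) (cancel q′ r r′ (+ d)))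
    where
    expand : ∀ q q′ r d → (q - q′) * d ≡ (q * d + r) - r - q′ * d
    expand = solve-∀
    cancel : ∀ q′ r r′ d → (q′ * d + r′) - r - q′ * d ≡ r′ - r
    cancel = solve-∀
  q-q′≡0 : q - q′ ≡ + 0
  q-q′≡0 = multiple<⇒0 (q - q′) d (r′ - r) ∣r′-r∣<d difference
  q≡q′ : q ≡ q′
  q≡q′ = ℤP.i-j≡0⇒i≡j q q′ q-q′≡0
  r≡r′ : r ≡ r′
  r≡r′ = sym (ℤP.i-j≡0⇒i≡j r′ r (trans (sym difference) (cong (_* + d) q-q′≡0)))

∣m-n∣<d : ∀ {m n d} → m ℕ.< d → n ℕ.< d → ∣ + m - + n ∣ ℕ.< d
∣m-n∣<d {m} {n} m<d n<d rewrite ℤP.m-n≡m⊖n m n with ℕP.≤-total n m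
... | inj₁ n≤m rewrite ℤP.⊖-≥ n≤m = ℕP.≤-<-trans (ℕP.m∸n≤m m n) m<d
... | inj₂ m≤n rewrite ℤP.∣⊖∣-≤ m≤n = ℕP.≤-<-trans (ℕP.m∸n≤m n m) n<d

divMod-of : ∀ d .{{_ : ℕ.NonZero d}} q r → r ℕ.< d → (+ r + q * + d) /ℕ d ≡ q × (+ r + q * + d) %ℕ d ≡ r
divMod-of d q r r<d =
  Data.Product.map sym (λ e → sym (ℤP.+-injective e))
    (euclid-unique d q (x /ℕ d) (+ r) (+ (x %ℕ d)) (∣m-n∣<d (DivMod.n%ℕd<d x d) r<d)
      (trans (ℤP.+-comm (q * + d) (+ r)) (trans (DivMod.a≡a%ℕn+[a/ℕn]*n x d) (ℤP.+-comm _ (x /ℕ d * + d)))))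
  where x = + r + q * + d

≡ᵇ-true : ∀ {m k} → m ≡ k → (m ℕ.≡ᵇ k) ≡ true
≡ᵇ-true {m} {k} m≡k = Equivalence.to T-≡ (ℕP.≡⇒≡ᵇ m k m≡k)

≡ᵇ-false : ∀ {m k} → m ≢ k → (m ℕ.≡ᵇ k) ≡ false
≡ᵇ-false {m} {k} m≢k = ¬-not (λ e → m≢k (ℕP.≡ᵇ⇒≡ m k (Equivalence.from T-≡ e)))

≡ᵇ-false⇒≢ : ∀ m k → (m ℕ.≡ᵇ k) ≡ false → m ≢ k
≡ᵇ-false⇒≢ m k e m≡k = subst T e (ℕP.≡⇒≡ᵇ m k m≡k)

≤ᵇ-true : ∀ {m k} → m ℕ.≤ k → (m ℕ.≤ᵇ k) ≡ true
≤ᵇ-true {m} {k} m≤k = Equivalence.to T-≡ (ℕP.≤⇒≤ᵇ m≤k)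

≤ᵇ-false : ∀ {m k} → k ℕ.< m → (m ℕ.≤ᵇ k) ≡ false
≤ᵇ-false {m} {k} k<m = ¬-not (λ e → ℕP.<⇒≱ k<m (ℕP.≤ᵇ⇒≤ m k (Equivalence.from T-≡ e)))

Nmod≡ : ∀ n → Nmod n ≡ suc (suc n) ℕ.+ n
Nmod≡ n = cong (λ m → suc (suc (n ℕ.+ m))) (ℕP.+-identityʳ n)

Nmod≡2[n+1] : ∀ n → Nmod n ≡ suc n ℕ.+ suc n
Nmod≡2[n+1] n = trans (Nmod≡ n) (cong suc (sym (ℕP.+-suc n n)))

module _ {A : Set} where

  mapHead : (A → A) → List A → List A
  mapHead f []       = []
  mapHead f (x ∷ xs) = f x ∷ xs

  mapLast : (A → A) → List A → List A
  mapLast f []           = []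
  mapLast f (x ∷ [])     = f x ∷ []
  mapLast f (x ∷ y ∷ ys) = x ∷ mapLast f (y ∷ ys)

  lastOf : A → List A → A
  lastOf x []       = x
  lastOf x (y ∷ ys) = lastOf y ys

  swapAt : ℕ → List A → List A
  swapAt zero    (x ∷ y ∷ xs) = y ∷ x ∷ xs
  swapAt (suc i) (x ∷ xs)     = x ∷ swapAt i xs
  swapAt _       xs           = xs

  swapAt-↭ : ∀ i xs → swapAt i xs ↭ xs
  swapAt-↭ zero    []           = ↭-refl
  swapAt-↭ zero    (x ∷ [])     = ↭-refl
  swapAt-↭ zero    (x ∷ y ∷ xs) = ↭-swap y x ↭-refl
  swapAt-↭ (suc i) []           = ↭-refl
  swapAt-↭ (suc i) (x ∷ xs)     = ↭-prep x (swapAt-↭ i xs)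

  length-mapHead : ∀ f xs → length (mapHead f xs) ≡ length xs
  length-mapHead f []       = refl
  length-mapHead f (x ∷ xs) = refl

  length-mapLast : ∀ f xs → length (mapLast f xs) ≡ length xs
  length-mapLast f []           = refl
  length-mapLast f (x ∷ [])     = refl
  length-mapLast f (x ∷ y ∷ ys) = cong suc (length-mapLast f (y ∷ ys))

  module _ {f : A → A} (f-involutive : ∀ x → f (f x) ≡ x) where

    mapHead-involutive : ∀ xs → mapHead f (mapHead f xs) ≡ xs
    mapHead-involutive []       = refl
    mapHead-involutive (x ∷ xs) = cong (_∷ xs) (f-involutive x)

    mapLast-involutive : ∀ xs → mapLast f (mapLast f xs) ≡ xs
    mapLast-involutive []       = refl
    mapLast-involutive (x ∷ []) = cong (_∷ []) (f-involutive x)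
    mapLast-involutive (x ∷ y ∷ ys)
      with mapLast f (y ∷ ys) | mapLast-involutive (y ∷ ys) | length-mapLast f (y ∷ ys)
    ... | z ∷ zs | ih | _ = cong (x ∷_) ih

  swapAt-involutive : ∀ i xs → swapAt i (swapAt i xs) ≡ xs
  swapAt-involutive zero    []           = refl
  swapAt-involutive zero    (x ∷ [])     = refl
  swapAt-involutive zero    (x ∷ y ∷ xs) = refl
  swapAt-involutive (suc i) []           = refl
  swapAt-involutive (suc i) (x ∷ xs)     = cong (x ∷_) (swapAt-involutive i xs)

  module _ {P : A → Set} {f : A → A} (pres : ∀ x → P x → P (f x)) where

    All-mapHead : ∀ {xs} → All P xs → All P (mapHead f xs)
    All-mapHead []         = []
    All-mapHead (px ∷ pxs) = pres _ px ∷ pxs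

    All-mapLast : ∀ {xs} → All P xs → All P (mapLast f xs)
    All-mapLast []               = []
    All-mapLast (px ∷ [])        = pres _ px ∷ []
    All-mapLast (px ∷ py ∷ pxs)  = px ∷ All-mapLast (py ∷ pxs)

  module _ {R : A → A → Set} where

    AllPairs-mapHead : ∀ {f} → (∀ x y → R x y → R (f x) y) → ∀ {xs} → AllPairs R xs → AllPairs R (mapHead f xs)
    AllPairs-mapHead pres {[]} []         = []
    AllPairs-mapHead pres {x ∷ _} (rx ∷ rxs) = All.map (pres x _) rx ∷ rxs

    AllPairs-mapLast : ∀ {f} → (∀ x y → R x y → R x (f y)) → ∀ {xs} → AllPairs R xs → AllPairs R (mapLast f xs)
    AllPairs-mapLast pres {[]}         []         = []
    AllPairs-mapLast pres {x ∷ []}     (rx ∷ rxs) = [] ∷ []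
    AllPairs-mapLast pres {x ∷ y ∷ ys} (rx ∷ rxs) = All-mapLast (pres x) rx ∷ AllPairs-mapLast pres rxs

    AllPairs-swapAt : Symmetric R → ∀ i {xs} → AllPairs R xs → AllPairs R (swapAt i xs)
    AllPairs-swapAt sym zero    {[]}         []                        = []
    AllPairs-swapAt sym zero    {x ∷ []}     rxs                       = rxs
    AllPairs-swapAt sym zero    {x ∷ y ∷ xs} ((rxy ∷ rx) ∷ ry ∷ rxs)   = (sym rxy ∷ ry) ∷ rx ∷ rxs
    AllPairs-swapAt sym (suc i) {[]}         []                        = []
    AllPairs-swapAt sym (suc i) {x ∷ xs}     (rx ∷ rxs)                =
      All-resp-↭ (↭-sym (swapAt-↭ i xs)) rx ∷ AllPairs-swapAt sym i rxs

  module _ (g : A → ℕ) where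

    sum-map-mapHead : ∀ {f} → (∀ x → g (f x) ≡ g x) → ∀ xs → sum (map g (mapHead f xs)) ≡ sum (map g xs)
    sum-map-mapHead g∘f≗g []       = refl
    sum-map-mapHead g∘f≗g (x ∷ xs) = cong (ℕ._+ sum (map g xs)) (g∘f≗g x)

    sum-map-swapAt : ∀ i xs → sum (map g (swapAt i xs)) ≡ sum (map g xs)
    sum-map-swapAt i xs = sum-↭ (map⁺ g (swapAt-↭ i xs))

    sum-map-mapLast : ∀ {f} → (∀ x → g (f x) ≡ g x) → ∀ xs → sum (map g (mapLast f xs)) ≡ sum (map g xs)
    sum-map-mapLast g∘f≗g []           = refl
    sum-map-mapLast g∘f≗g (x ∷ [])     = cong (ℕ._+ 0) (g∘f≗g x)
    sum-map-mapLast g∘f≗g (x ∷ y ∷ ys) = cong (g x ℕ.+_) (sum-map-mapLast g∘f≗g (y ∷ ys))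

    sum-map-mapLast-exchange : ∀ f x xs →
      sum (map g (mapLast f (x ∷ xs))) ℕ.+ g (lastOf x xs) ≡ sum (map g (x ∷ xs)) ℕ.+ g (f (lastOf x xs))
    sum-map-mapLast-exchange f x []       = swap-ends (g (f x)) (g x)
      where
      swap-ends : ∀ a b → a ℕ.+ 0 ℕ.+ b ≡ b ℕ.+ 0 ℕ.+ a
      swap-ends = ℕSolver.solve-∀
    sum-map-mapLast-exchange f x (y ∷ ys) = trans (ℕP.+-assoc (g x) _ _) (trans (cong (g x ℕ.+_) (sum-map-mapLast-exchange f y ys))
                                          (sym (ℕP.+-assoc (g x) _ _)))

All-lastOf : ∀ {A : Set} {P : A → Set} x xs → All P (x ∷ xs) → P (lastOf x xs)
All-lastOf x []       (px ∷ [])  = px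
All-lastOf x (y ∷ ys) (_ ∷ pys)  = All-lastOf y ys pys

-- (q , s) stands for the window entry q N + s; negInd t is the indicator [t < 0].
Entry : Set
Entry = ℤ × ℤ

negInd : ℤ → ℤ
negInd (+ _)    = + 0
negInd -[1+ _ ] = + 1

negInd-neg : ∀ t → t ≢ + 0 → negInd (- t) ≡ + 1 - negInd t
negInd-neg (+ zero)  t≢0 = ⊥-elim (t≢0 refl)
negInd-neg (+ suc _) _   = refl
negInd-neg -[1+ _ ]  _   = refl

negInd-nonneg : ∀ {t} → + 0 ℤ.≤ t → negInd t ≡ + 0
negInd-nonneg {+ _} _ = refl

negInd-k<j : ∀ {k j} → k ℕ.< j → negInd (+ k - + j) ≡ + 1
negInd-k<j {k} {j} k<j rewrite ℤP.m-n≡m⊖n k j | ℤP.⊖-< k<j with j ℕ.∸ k | ℕP.m>n⇒m∸n≢0 k<j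
... | suc _ | _   = refl
... | zero  | j∸k≢0 = ⊥-elim (j∸k≢0 refl)

negInd-of-neg : ∀ {t u} → t ≡ - u → u ≢ + 0 → negInd t ≡ + 1 - negInd u
negInd-of-neg {u = u} refl u≢0 = negInd-neg u u≢0

selfTerm : Entry → ℤ
selfTerm (q , s) = (q + q) - negInd s

diffTerm : Entry → Entry → ℤ
diffTerm (qx , sx) (qy , sy) = (qx - qy) - negInd (sx - sy)

sumTerm : Entry → Entry → ℤ
sumTerm (qx , sx) (qy , sy) = (qx + qy) - negInd (sx + sy)

selfInv : Entry → ℕ
selfInv x = ∣ selfTerm x ∣

pairInv : Entry → Entry → ℕ
pairInv x y = ∣ diffTerm x y + + 1 ∣ ℕ.+ ∣ sumTerm x y ∣

negate : Entry → Entry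
negate (q , s) = (- q , - s)

reflect : Entry → Entry
reflect (q , s) = (+ 1 - q , - s)

Apart : Entry → Entry → Set
Apart x y = ∣ proj₂ x ∣ ≢ ∣ proj₂ y ∣

Nonzero : Entry → Set
Nonzero x = proj₂ x ≢ + 0

selfInv-negate : ∀ x → Nonzero x → selfInv (negate x) ≡ ∣ selfTerm x + + 1 ∣
selfInv-negate (q , s) s≢0 rewrite negInd-neg s s≢0 =
  trans (cong ∣_∣ (identity q (negInd s))) (ℤP.∣-i∣≡∣i∣ ((q + q) - negInd s + + 1))
  where
  identity : ∀ q m → (- q + - q) - (+ 1 - m) ≡ - ((q + q) - m + + 1)
  identity = solve-∀

selfInv-reflect : ∀ x → Nonzero x → selfInv (reflect x) ≡ ∣ - selfTerm x + + 1 ∣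
selfInv-reflect (q , s) s≢0 rewrite negInd-neg s s≢0 = cong ∣_∣ (identity q (negInd s))
  where
  identity : ∀ q m → ((+ 1 - q) + (+ 1 - q)) - (+ 1 - m) ≡ - ((q + q) - m) + + 1
  identity = solve-∀

diffTerm-negateˡ : ∀ x y → Apart x y → diffTerm (negate x) y + + 1 ≡ - sumTerm x y
diffTerm-negateˡ (qx , sx) (qy , sy) x#y =
  trans (cong (λ m → (- qx - qy) - m + + 1) (negInd-of-neg (negated sx sy) (∣a∣≢∣b∣⇒a+b≢0 sx sy x#y)))
        (identity qx qy (negInd (sx + sy)))
  where
  negated : ∀ a b → - a - b ≡ - (a + b)
  negated = solve-∀
  identity : ∀ a b m → (- a - b) - (+ 1 - m) + + 1 ≡ - ((a + b) - m)
  identity = solve-∀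

sumTerm-negateˡ : ∀ x y → Apart x y → sumTerm (negate x) y ≡ - (diffTerm x y + + 1)
sumTerm-negateˡ (qx , sx) (qy , sy) x#y =
  trans (cong (λ m → (- qx + qy) - m) (negInd-of-neg (negated sx sy) (∣a∣≢∣b∣⇒a-b≢0 sx sy x#y)))
        (identity qx qy (negInd (sx - sy)))
  where
  negated : ∀ a b → - a + b ≡ - (a - b)
  negated = solve-∀
  identity : ∀ a b m → (- a + b) - (+ 1 - m) ≡ - ((a - b) - m + + 1)
  identity = solve-∀

diffTerm-reflectʳ : ∀ x y → diffTerm x (reflect y) + + 1 ≡ sumTerm x y
diffTerm-reflectʳ (qx , sx) (qy , sy) =
  trans (cong (λ t → (qx - (+ 1 - qy)) - negInd t + + 1) (doubleNeg sx sy)) (identity qx qy (negInd (sx + sy)))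
  where
  doubleNeg : ∀ a b → a - - b ≡ a + b
  doubleNeg = solve-∀
  identity : ∀ a b m → (a - (+ 1 - b)) - m + + 1 ≡ (a + b) - m
  identity = solve-∀

sumTerm-reflectʳ : ∀ x y → sumTerm x (reflect y) ≡ diffTerm x y + + 1
sumTerm-reflectʳ (qx , sx) (qy , sy) = identity qx qy (negInd (sx - sy))
  where
  identity : ∀ a b m → (a + (+ 1 - b)) - m ≡ (a - b) - m + + 1
  identity = solve-∀

diffTerm-swap : ∀ x y → Apart x y → diffTerm y x + + 1 ≡ - diffTerm x y
diffTerm-swap (qx , sx) (qy , sy) x#y =
  trans (cong (λ m → (qy - qx) - m + + 1) (negInd-of-neg (negated sx sy) (∣a∣≢∣b∣⇒a-b≢0 sx sy x#y)))
        (identity qx qy (negInd (sx - sy)))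
  where
  negated : ∀ a b → b - a ≡ - (a - b)
  negated = solve-∀
  identity : ∀ a b m → (b - a) - (+ 1 - m) + + 1 ≡ - ((a - b) - m)
  identity = solve-∀

sumTerm-swap : ∀ x y → sumTerm y x ≡ sumTerm x y
sumTerm-swap (qx , sx) (qy , sy) = cong₂ (λ q s → q - negInd s) (ℤP.+-comm qy qx) (ℤP.+-comm sy sx)

pairInv-negateˡ : ∀ x y → Apart x y → pairInv (negate x) y ≡ pairInv x y
pairInv-negateˡ x y x#y =
  trans (cong₂ ℕ._+_ (∣-∣-cong-neg (diffTerm-negateˡ x y x#y)) (∣-∣-cong-neg (sumTerm-negateˡ x y x#y)))
        (ℕP.+-comm ∣ sumTerm x y ∣ _)

pairInv-reflectʳ : ∀ x y → pairInv x (reflect y) ≡ pairInv x y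
pairInv-reflectʳ x y =
  trans (cong₂ ℕ._+_ (cong ∣_∣ (diffTerm-reflectʳ x y)) (cong ∣_∣ (sumTerm-reflectʳ x y)))
        (ℕP.+-comm ∣ sumTerm x y ∣ _)

pairInv-swap : ∀ x y → Apart x y → pairInv y x ≡ ∣ diffTerm x y ∣ ℕ.+ ∣ sumTerm x y ∣
pairInv-swap x y x#y = cong₂ ℕ._+_ (∣-∣-cong-neg (diffTerm-swap x y x#y)) (cong ∣_∣ (sumTerm-swap x y))

selfTerm>0 : ∀ k s → + 0 ℤ.< selfTerm (+ suc k , s)
selfTerm>0 k (+ _)    = ℤ.+<+ (ℕ.s≤s ℕ.z≤n)
selfTerm>0 k -[1+ _ ] rewrite ℕP.+-suc k k = ℤ.+<+ (ℕ.s≤s ℕ.z≤n)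

level≥0 : ∀ x → + 0 ℤ.≤ selfTerm x → + 0 ℤ.≤ proj₁ x
level≥0 (+ _ , _)                 _  = ℤ.+≤+ ℕ.z≤n
level≥0 (-[1+ _ ] , + _)          ()
level≥0 (-[1+ _ ] , -[1+ _ ])     ()

level≤0 : ∀ x → + 0 ℤ.≤ - selfTerm x → proj₁ x ℤ.≤ + 0
level≤0 (+ zero , _)    _ = ℤ.+≤+ ℕ.z≤n
level≤0 (-[1+ _ ] , _)  _ = ℤ.-≤+
level≤0 (+ suc k , s) 0≤-t =
  ⊥-elim (ℤP.<⇒≱ (selfTerm>0 k s) (subst (ℤ._≤ + 0) (ℤP.neg-involutive _) (ℤP.neg-mono-≤ 0≤-t)))

Window : Set
Window = List Entry

-- Out of range, nth returns the junk entry (0 , 0).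
nth : Window → ℕ → Entry
nth []       _       = (+ 0 , + 0)
nth (x ∷ xs) zero    = x
nth (x ∷ xs) (suc j) = nth xs j

pairInvs : Entry → Window → ℕ
pairInvs x ys = sum (map (pairInv x) ys)

inversions : Window → ℕ
inversions []       = 0
inversions (x ∷ xs) = selfInv x ℕ.+ pairInvs x xs ℕ.+ inversions xs

levelSum : Window → ℕ
levelSum l = sum (map (∣_∣ ∘ proj₁) l)

pairInvs-negate : ∀ x {ys} → All (Apart x) ys → pairInvs (negate x) ys ≡ pairInvs x ys
pairInvs-negate x []                = refl
pairInvs-negate x {y ∷ _} (x#y ∷ x#ys) = cong₂ ℕ._+_ (pairInv-negateˡ x y x#y) (pairInvs-negate x x#ys)

inversions-negateHead : ∀ x xs → All (Apart x) xs → Nonzero x →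
  inversions (negate x ∷ xs) ≡ ∣ selfTerm x + + 1 ∣ ℕ.+ pairInvs x xs ℕ.+ inversions xs
inversions-negateHead x xs x#xs x≢0 rewrite selfInv-negate x x≢0 | pairInvs-negate x x#xs = refl

inversions-reflectLast : ∀ x xs → Nonzero (lastOf x xs) →
  inversions (mapLast reflect (x ∷ xs)) ℕ.+ selfInv (lastOf x xs)
    ≡ inversions (x ∷ xs) ℕ.+ ∣ - selfTerm (lastOf x xs) + + 1 ∣
inversions-reflectLast x [] x≢0 rewrite selfInv-reflect x x≢0 = swap-ends ∣ - selfTerm x + + 1 ∣ (selfInv x)
  where
  swap-ends : ∀ a b → a ℕ.+ 0 ℕ.+ 0 ℕ.+ b ≡ b ℕ.+ 0 ℕ.+ 0 ℕ.+ a
  swap-ends = ℕSolver.solve-∀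
inversions-reflectLast x (y ∷ ys) last≢0 = begin
    selfInv x ℕ.+ pairInvs x ys′ ℕ.+ inversions ys′ ℕ.+ selfInv z
  ≡⟨ cong (λ p → selfInv x ℕ.+ p ℕ.+ inversions ys′ ℕ.+ selfInv z)
          (sum-map-mapLast (pairInv x) (pairInv-reflectʳ x) (y ∷ ys)) ⟩
    h ℕ.+ inversions ys′ ℕ.+ selfInv z
  ≡⟨ ℕP.+-assoc h _ _ ⟩
    h ℕ.+ (inversions ys′ ℕ.+ selfInv z)
  ≡⟨ cong (h ℕ.+_) (inversions-reflectLast y ys last≢0) ⟩
    h ℕ.+ (inversions (y ∷ ys) ℕ.+ ∣ - selfTerm z + + 1 ∣)
  ≡⟨ ℕP.+-assoc h _ _ ⟨
    h ℕ.+ inversions (y ∷ ys) ℕ.+ ∣ - selfTerm z + + 1 ∣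
  ∎
  where
  open ≡-Reasoning
  ys′ = mapLast reflect (y ∷ ys)
  z = lastOf y ys
  h = selfInv x ℕ.+ pairInvs x (y ∷ ys)

inversions-swapAt : ∀ i l → suc i ℕ.< length l →
  inversions (swapAt i l) ℕ.+ pairInv (nth l i) (nth l (suc i))
    ≡ inversions l ℕ.+ pairInv (nth l (suc i)) (nth l i)
inversions-swapAt zero (x ∷ y ∷ l) _ =
  exchange (selfInv x) (selfInv y) (pairInv x y) (pairInv y x) (pairInvs x l) (pairInvs y l) (inversions l)
  where
  exchange : ∀ a b c d e f h → b ℕ.+ (d ℕ.+ f) ℕ.+ (a ℕ.+ e ℕ.+ h) ℕ.+ c ≡ a ℕ.+ (c ℕ.+ e) ℕ.+ (b ℕ.+ f ℕ.+ h) ℕ.+ d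
  exchange = ℕSolver.solve-∀
inversions-swapAt zero (x ∷ []) (ℕ.s≤s ())
inversions-swapAt (suc i) (x ∷ l) (ℕ.s≤s i<∣l∣) = begin
    selfInv x ℕ.+ pairInvs x (swapAt i l) ℕ.+ inversions (swapAt i l) ℕ.+ p
  ≡⟨ cong (λ t → selfInv x ℕ.+ t ℕ.+ inversions (swapAt i l) ℕ.+ p) (sum-map-swapAt (pairInv x) i l) ⟩
    h ℕ.+ inversions (swapAt i l) ℕ.+ p
  ≡⟨ ℕP.+-assoc h _ _ ⟩
    h ℕ.+ (inversions (swapAt i l) ℕ.+ p)
  ≡⟨ cong (h ℕ.+_) (inversions-swapAt i l i<∣l∣) ⟩
    h ℕ.+ (inversions l ℕ.+ p′)
  ≡⟨ ℕP.+-assoc h _ _ ⟨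
    h ℕ.+ inversions l ℕ.+ p′
  ∎
  where
  open ≡-Reasoning
  h = selfInv x ℕ.+ pairInvs x l
  p = pairInv (nth l i) (nth l (suc i))
  p′ = pairInv (nth l (suc i)) (nth l i)

AllPairs-nth-adjacent : ∀ {R : Entry → Entry → Set} i l → AllPairs R l → suc i ℕ.< length l → R (nth l i) (nth l (suc i))
AllPairs-nth-adjacent zero    (x ∷ y ∷ l) ((rxy ∷ _) ∷ _) _             = rxy
AllPairs-nth-adjacent zero    (x ∷ [])    _               (ℕ.s≤s ())
AllPairs-nth-adjacent (suc i) (x ∷ l)     (_ ∷ rl)        (ℕ.s≤s i<∣l∣) = AllPairs-nth-adjacent i l rl i<∣l∣

Bounded : ℕ → Entry → Set
Bounded n x = 1 ℕ.≤ ∣ proj₂ x ∣ × ∣ proj₂ x ∣ ℕ.≤ n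

Valid : ℕ → Window → Set
Valid n l = length l ≡ n × All (Bounded n) l × AllPairs Apart l

ResiduePreserving : (Entry → Entry) → Set
ResiduePreserving f = ∀ x → ∣ proj₂ (f x) ∣ ≡ ∣ proj₂ x ∣

negate-residue : ResiduePreserving negate
negate-residue (q , s) = ℤP.∣-i∣≡∣i∣ s

reflect-residue : ResiduePreserving reflect
reflect-residue (q , s) = ℤP.∣-i∣≡∣i∣ s

negate-involutive : ∀ x → negate (negate x) ≡ x
negate-involutive (q , s) = cong₂ _,_ (ℤP.neg-involutive q) (ℤP.neg-involutive s)

reflect-involutive : ∀ x → reflect (reflect x) ≡ x
reflect-involutive (q , s) = cong₂ _,_ (identity q) (ℤP.neg-involutive s)
  where
  identity : ∀ q → + 1 - (+ 1 - q) ≡ q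
  identity = solve-∀

Bounded≢0 : ∀ {n} x → Bounded n x → Nonzero x
Bounded≢0 (q , + zero) (() , _) refl

module _ {f : Entry → Entry} (f-residue : ResiduePreserving f) where

  Bounded-resp : ∀ {n} x → Bounded n x → Bounded n (f x)
  Bounded-resp x rewrite f-residue x = λ bx → bx

  Apart-respˡ : ∀ x y → Apart x y → Apart (f x) y
  Apart-respˡ x y x#y e = x#y (trans (sym (f-residue x)) e)

  Apart-respʳ : ∀ x y → Apart x y → Apart x (f y)
  Apart-respʳ x y x#y e = x#y (trans e (f-residue y))

  Valid-mapHead : ∀ {n l} → Valid n l → Valid n (mapHead f l)
  Valid-mapHead {l = l} (∣l∣ , bl , al) =
    trans (length-mapHead f l) ∣l∣ , All-mapHead Bounded-resp bl , AllPairs-mapHead Apart-respˡ al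

  Valid-mapLast : ∀ {n l} → Valid n l → Valid n (mapLast f l)
  Valid-mapLast {l = l} (∣l∣ , bl , al) =
    trans (length-mapLast f l) ∣l∣ , All-mapLast Bounded-resp bl , AllPairs-mapLast Apart-respʳ al

Valid-swapAt : ∀ {n} i {l} → Valid n l → Valid n (swapAt i l)
Valid-swapAt i {l} (∣l∣ , bl , al) =
  trans (↭-length (swapAt-↭ i l)) ∣l∣ , All-resp-↭ (↭-sym (swapAt-↭ i l)) bl , AllPairs-swapAt (λ x#y → x#y ∘ sym) i al

-- The action of the generators

-- The case split mirrors the two tests in genWin.
actOn : (first last : Bool) → ℕ → Window → Window
actOn true  _     _ = mapHead negate
actOn false true  _ = mapLast reflect
actOn false false i = swapAt (i ℕ.∸ 1)

act : ∀ n → Fin (suc n) → Window → Window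
act n a = actOn (toℕ a ℕ.≡ᵇ 0) (toℕ a ℕ.≡ᵇ n) (toℕ a)

actWord : ∀ n → Window → List (Fin (suc n)) → Window
actWord n = foldl (λ l a → act n a l)

actOn-involutive : ∀ first last i l → actOn first last i (actOn first last i l) ≡ l
actOn-involutive true  _     _ = mapHead-involutive negate-involutive
actOn-involutive false true  _ = mapLast-involutive reflect-involutive
actOn-involutive false false i = swapAt-involutive (i ℕ.∸ 1)

act-involutive : ∀ n a l → act n a (act n a l) ≡ l
act-involutive n a = actOn-involutive (toℕ a ℕ.≡ᵇ 0) (toℕ a ℕ.≡ᵇ n) (toℕ a)

Valid-actOn : ∀ {n} first last i {l} → Valid n l → Valid n (actOn first last i l)
Valid-actOn true  _     _ = Valid-mapHead negate-residue
Valid-actOn false true  _ = Valid-mapLast reflect-residue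
Valid-actOn false false i = Valid-swapAt (i ℕ.∸ 1)

Valid-act : ∀ n a {l} → Valid n l → Valid n (act n a l)
Valid-act n a = Valid-actOn (toℕ a ℕ.≡ᵇ 0) (toℕ a ℕ.≡ᵇ n) (toℕ a)

Valid-actWord : ∀ n ρ {l} → Valid n l → Valid n (actWord n l ρ)
Valid-actWord n []      v = v
Valid-actWord n (a ∷ ρ) v = Valid-actWord n ρ (Valid-act n a v)

act-last : ∀ m a l → toℕ a ≡ suc m → act (suc m) a l ≡ mapLast reflect l
act-last m a l a≡m+1 rewrite a≡m+1 | ≡ᵇ-true {m} refl = refl

act-middle : ∀ n a i l → toℕ a ≡ suc i → suc i ℕ.< n → act n a l ≡ swapAt i l
act-middle n a i l a≡i+1 i+1<n rewrite a≡i+1 | ≡ᵇ-false (ℕP.<⇒≢ i+1<n) = refl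

-- Inversions change by one

data StepFrom (δ : ℕ) (l l′ : Window) : Set where
  up    : inversions l′ ≡ suc (inversions l) → levelSum l′ ≡ δ ℕ.+ levelSum l → StepFrom δ l l′
  notUp : inversions l′ ℕ.≤ inversions l → StepFrom δ l l′

module _ (x : Entry) (xs : Window) (x#xs : All (Apart x) xs) (x≢0 : Nonzero x) where

  negateHead-up : + 0 ℤ.≤ selfTerm x → inversions (negate x ∷ xs) ≡ suc (inversions (x ∷ xs))
  negateHead-up 0≤t = trans (inversions-negateHead x xs x#xs x≢0)
                            (cong (λ a → a ℕ.+ pairInvs x xs ℕ.+ inversions xs) (∣t+1∣≡1+∣t∣ 0≤t))

  negateHead-down : selfTerm x ℤ.< + 0 → suc (inversions (negate x ∷ xs)) ≡ inversions (x ∷ xs)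
  negateHead-down t<0 = trans (cong suc (inversions-negateHead x xs x#xs x≢0))
                              (cong (λ a → a ℕ.+ pairInvs x xs ℕ.+ inversions xs) (sym (∣t∣≡1+∣t+1∣ t<0)))

module _ (x : Entry) (xs : Window) (y≢0 : Nonzero (lastOf x xs)) where

  private
    y = lastOf x xs
    l′ = mapLast reflect (x ∷ xs)

  reflectLast-up : + 0 ℤ.≤ - selfTerm y → inversions l′ ≡ suc (inversions (x ∷ xs))
  reflectLast-up 0≤t = sym (+-suc-cancel (inversions (x ∷ xs)) (inversions l′) (selfInv y) (sym
    (trans (inversions-reflectLast x xs y≢0)
           (cong (inversions (x ∷ xs) ℕ.+_) (trans (∣t+1∣≡1+∣t∣ 0≤t) (cong suc (ℤP.∣-i∣≡∣i∣ (selfTerm y))))))))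

  reflectLast-down : - selfTerm y ℤ.< + 0 → suc (inversions l′) ≡ inversions (x ∷ xs)
  reflectLast-down t<0 = +-suc-cancel (inversions l′) (inversions (x ∷ xs)) ∣ - selfTerm y + + 1 ∣
    (trans (cong (inversions l′ ℕ.+_) (trans (sym (∣t∣≡1+∣t+1∣ t<0)) (ℤP.∣-i∣≡∣i∣ (selfTerm y))))
           (inversions-reflectLast x xs y≢0))

  levelSum-reflectLast : + 0 ℤ.≤ - selfTerm y → levelSum l′ ≡ 1 ℕ.+ levelSum (x ∷ xs)
  levelSum-reflectLast 0≤t = sym (+-suc-cancel (levelSum (x ∷ xs)) (levelSum l′) ∣ proj₁ y ∣ (sym
    (trans (sum-map-mapLast-exchange (∣_∣ ∘ proj₁) reflect x xs)
           (cong (levelSum (x ∷ xs) ℕ.+_) (∣1-q∣≡1+∣q∣ (level≤0 y 0≤t))))))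

module _ (i : ℕ) (l : Window) (al : AllPairs Apart l) (i+1<∣l∣ : suc i ℕ.< length l) where

  private
    x = nth l i
    y = nth l (suc i)
    l′ = swapAt i l
    S = ∣ sumTerm x y ∣

    exchange : inversions l′ ℕ.+ (∣ diffTerm x y + + 1 ∣ ℕ.+ S) ≡ inversions l ℕ.+ (∣ diffTerm x y ∣ ℕ.+ S)
    exchange = trans (inversions-swapAt i l i+1<∣l∣)
                     (cong (inversions l ℕ.+_) (pairInv-swap x y (AllPairs-nth-adjacent i l al i+1<∣l∣)))

  swapAt-up : diffTerm x y ℤ.< + 0 → inversions l′ ≡ suc (inversions l)
  swapAt-up t<0 = sym (+-suc-cancel (inversions l) (inversions l′) (∣ diffTerm x y + + 1 ∣ ℕ.+ S)
    (sym (trans exchange (cong (λ a → inversions l ℕ.+ (a ℕ.+ S)) (∣t∣≡1+∣t+1∣ t<0)))))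

  swapAt-down : + 0 ℤ.≤ diffTerm x y → suc (inversions l′) ≡ inversions l
  swapAt-down 0≤t = +-suc-cancel (inversions l′) (inversions l) (∣ diffTerm x y ∣ ℕ.+ S)
    (trans (cong (λ a → inversions l′ ℕ.+ (a ℕ.+ S)) (sym (∣t+1∣≡1+∣t∣ 0≤t))) exchange)

step-down : ∀ {δ l l′} → suc (inversions l′) ≡ inversions l → StepFrom δ l l′
step-down e = notUp (ℕP.<⇒≤ (ℕP.≤-reflexive e))

actOn-step : ∀ {n} i first last {l} → (i ℕ.≡ᵇ 0) ≡ first → (i ℕ.≡ᵇ n) ≡ last → i ℕ.≤ n → Valid n l →
  StepFrom (if last then 1 else 0) l (actOn first last i l)
actOn-step zero    true _ {[]}     _ _ _ _ = notUp ℕP.≤-refl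
actOn-step zero    true _ {x ∷ xs} _ refl _ (refl , bx ∷ _ , x#xs ∷ _)
  with + 0 ℤ.≤? selfTerm x
... | yes 0≤t = up (negateHead-up x xs x#xs (Bounded≢0 x bx) 0≤t)
                    (sum-map-mapHead (∣_∣ ∘ proj₁) {negate} (λ z → ℤP.∣-i∣≡∣i∣ (proj₁ z)) (x ∷ xs))
... | no  0≰t = step-down (negateHead-down x xs x#xs (Bounded≢0 x bx) (ℤP.≰⇒> 0≰t))
actOn-step (suc _) true _ () _ _ _
actOn-step _ false true {[]}     _ _ _ _ = notUp ℕP.≤-refl
actOn-step _ false true {x ∷ xs} _ _ _ (_ , bl , _)
  with + 0 ℤ.≤? - selfTerm (lastOf x xs)
... | yes 0≤t = up (reflectLast-up x xs y≢0 0≤t) (levelSum-reflectLast x xs y≢0 0≤t)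
  where y≢0 = Bounded≢0 (lastOf x xs) (All-lastOf x xs bl)
... | no  0≰t = step-down (reflectLast-down x xs y≢0 (ℤP.≰⇒> 0≰t))
  where y≢0 = Bounded≢0 (lastOf x xs) (All-lastOf x xs bl)
actOn-step zero false false () _ _ _
actOn-step {n} (suc i) false false {l} _ e2 i<n (∣l∣ , _ , al)
  with + 0 ℤ.≤? diffTerm (nth l i) (nth l (suc i))
... | yes 0≤t = step-down (swapAt-down i l al i+1<∣l∣ 0≤t)
  where i+1<∣l∣ = subst (suc i ℕ.<_) (sym ∣l∣) (ℕP.≤∧≢⇒< i<n (≡ᵇ-false⇒≢ (suc i) n e2))
... | no  0≰t = up (swapAt-up i l al i+1<∣l∣ (ℤP.≰⇒> 0≰t)) (sum-map-swapAt (∣_∣ ∘ proj₁) i l)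
  where i+1<∣l∣ = subst (suc i ℕ.<_) (sym ∣l∣) (ℕP.≤∧≢⇒< i<n (≡ᵇ-false⇒≢ (suc i) n e2))

act-step : ∀ n a {l} → Valid n l → StepFrom (if toℕ a ℕ.≡ᵇ n then 1 else 0) l (act n a l)
act-step n a = actOn-step (toℕ a) _ _ refl refl (ℕP.≤-pred (FinP.toℕ<n a))

inversions-actWord-≤ : ∀ n ρ {l} → Valid n l → inversions (actWord n l ρ) ℕ.≤ inversions l ℕ.+ length ρ
inversions-actWord-≤ n []      {l} _ = ℕP.≤-reflexive (sym (ℕP.+-identityʳ (inversions l)))
inversions-actWord-≤ n (a ∷ ρ) {l} v with act-step n a v
... | up ℓ′≡1+ℓ _ = begin
  inversions (actWord n l′ ρ)   ≤⟨ inversions-actWord-≤ n ρ v′ ⟩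
  inversions l′ ℕ.+ length ρ    ≡⟨ cong (ℕ._+ length ρ) ℓ′≡1+ℓ ⟩
  suc (inversions l) ℕ.+ length ρ ≡⟨ ℕP.+-suc (inversions l) (length ρ) ⟨
  inversions l ℕ.+ length (a ∷ ρ) ∎
  where
  open ℕP.≤-Reasoning
  l′ = act n a l
  v′ = Valid-act n a v
... | notUp ℓ′≤ℓ = begin
  inversions (actWord n l′ ρ)   ≤⟨ inversions-actWord-≤ n ρ v′ ⟩
  inversions l′ ℕ.+ length ρ    ≤⟨ ℕP.+-mono-≤ ℓ′≤ℓ (ℕP.n≤1+n (length ρ)) ⟩
  inversions l ℕ.+ length (a ∷ ρ) ∎
  where
  open ℕP.≤-Reasoning
  l′ = act n a l
  v′ = Valid-act n a v

-- When a word realises the bound, every letter raises ℓ, so each sₙ raises the level sum by one.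
levelSum-actWord : ∀ n ρ {l} → Valid n l → inversions (actWord n l ρ) ≡ inversions l ℕ.+ length ρ →
  levelSum (actWord n l ρ) ≡ levelSum l ℕ.+ countSn ρ
levelSum-actWord n []      {l} _ _ = sym (ℕP.+-identityʳ (levelSum l))
levelSum-actWord n (a ∷ ρ) {l} v tight with act-step n a v
... | up ℓ′≡1+ℓ L′≡δ+L = begin
  levelSum (actWord n l′ ρ)        ≡⟨ levelSum-actWord n ρ v′ tight′ ⟩
  levelSum l′ ℕ.+ countSn ρ        ≡⟨ cong (ℕ._+ countSn ρ) L′≡δ+L ⟩
  δ ℕ.+ levelSum l ℕ.+ countSn ρ   ≡⟨ cong (ℕ._+ countSn ρ) (ℕP.+-comm δ (levelSum l)) ⟩
  levelSum l ℕ.+ δ ℕ.+ countSn ρ   ≡⟨ ℕP.+-assoc (levelSum l) δ (countSn ρ) ⟩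
  levelSum l ℕ.+ countSn (a ∷ ρ)   ∎
  where
  open ≡-Reasoning
  δ = if toℕ a ℕ.≡ᵇ n then 1 else 0
  l′ = act n a l
  v′ = Valid-act n a v
  tight′ : inversions (actWord n l′ ρ) ≡ inversions l′ ℕ.+ length ρ
  tight′ = trans tight (trans (ℕP.+-suc (inversions l) (length ρ)) (cong (ℕ._+ length ρ) (sym ℓ′≡1+ℓ)))
... | notUp ℓ′≤ℓ = ⊥-elim (ℕP.<⇒≱ too-long (inversions-actWord-≤ n ρ v′))
  where
  l′ = act n a l
  v′ = Valid-act n a v
  too-long : inversions l′ ℕ.+ length ρ ℕ.< inversions (actWord n l′ ρ)
  too-long = begin-strict
    inversions l′ ℕ.+ length ρ   ≤⟨ ℕP.+-monoˡ-≤ (length ρ) ℓ′≤ℓ ⟩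
    inversions l ℕ.+ length ρ    <⟨ ℕP.+-monoʳ-< (inversions l) (ℕP.n<1+n (length ρ)) ⟩
    inversions l ℕ.+ length (a ∷ ρ) ≡⟨ tight ⟨
    inversions (actWord n l′ ρ)  ∎
    where open ℕP.≤-Reasoning

-- The identity window and descents

identityFrom : ℕ → ℕ → Window
identityFrom k zero    = []
identityFrom k (suc m) = (+ 0 , + k) ∷ identityFrom (suc k) m

identityWindow : ℕ → Window
identityWindow = identityFrom 1

length-identityFrom : ∀ k m → length (identityFrom k m) ≡ m
length-identityFrom k zero    = refl
length-identityFrom k (suc m) = cong suc (length-identityFrom (suc k) m)

nth-identityFrom : ∀ k m j → j ℕ.< m → nth (identityFrom k m) j ≡ (+ 0 , + (k ℕ.+ j))
nth-identityFrom k (suc m) zero    _            = cong (λ t → (+ 0 , + t)) (sym (ℕP.+-identityʳ k))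
nth-identityFrom k (suc m) (suc j) (ℕ.s≤s j<m) =
  trans (nth-identityFrom (suc k) m j j<m) (cong (λ t → (+ 0 , + t)) (sym (ℕP.+-suc k j)))

pairInvs-identityFrom : ∀ k j m → k ℕ.< j → pairInvs (+ 0 , + k) (identityFrom j m) ≡ 0
pairInvs-identityFrom k j zero    _   = refl
pairInvs-identityFrom k j (suc m) k<j
  rewrite negInd-k<j k<j = pairInvs-identityFrom k (suc j) m (ℕP.m<n⇒m<1+n k<j)

inversions-identityFrom : ∀ k m → inversions (identityFrom k m) ≡ 0
inversions-identityFrom k zero    = refl
inversions-identityFrom k (suc m)
  rewrite pairInvs-identityFrom k (suc k) m (ℕP.n<1+n k) = inversions-identityFrom (suc k) m

levelSum-identityFrom : ∀ k m → levelSum (identityFrom k m) ≡ 0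
levelSum-identityFrom k zero    = refl
levelSum-identityFrom k (suc m) = levelSum-identityFrom (suc k) m

Valid-identityWindow : ∀ n → Valid n (identityWindow n)
Valid-identityWindow n = length-identityFrom 1 n , bounded 1 n (ℕ.s≤s ℕ.z≤n) ℕP.≤-refl , apart 1 n
  where
  bounded : ∀ k m → 1 ℕ.≤ k → k ℕ.+ m ℕ.≤ suc n → All (Bounded n) (identityFrom k m)
  bounded k zero    _   _     = []
  bounded k (suc m) 1≤k k+m<n =
    (1≤k , ℕP.≤-pred (ℕP.≤-trans (ℕ.s≤s (ℕP.m≤m+n k m)) k+m<n′))
      ∷ bounded (suc k) m (ℕP.m≤n⇒m≤1+n 1≤k) k+m<n′
    where k+m<n′ = ℕP.≤-trans (ℕP.≤-reflexive (sym (ℕP.+-suc k m))) k+m<n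
  apartFrom : ∀ k j m → k ℕ.< j → All (Apart (+ 0 , + k)) (identityFrom j m)
  apartFrom k j zero    _   = []
  apartFrom k j (suc m) k<j = ℕP.<⇒≢ k<j ∷ apartFrom k (suc j) m (ℕP.m<n⇒m<1+n k<j)
  apart : ∀ k m → AllPairs Apart (identityFrom k m)
  apart k zero    = []
  apart k (suc m) = apartFrom k (suc k) m (ℕP.n<1+n k) ∷ apart (suc k) m

Ascending : Window → Set
Ascending = Linked (λ x y → diffTerm x y ℤ.< + 0)

diffTerm<0⇒level≤ : ∀ x y → diffTerm x y ℤ.< + 0 → proj₁ x ℤ.≤ proj₁ y
diffTerm<0⇒level≤ (qx , sx) (qy , sy) d with sx - sy
... | + _      = ℤP.i-j≤0⇒i≤j (ℤP.<⇒≤ (subst (ℤ._< + 0) (ℤP.+-identityʳ (qx - qy)) d))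
... | -[1+ _ ] = ℤP.i-j≤0⇒i≤j (subst (ℤ._≤ + 0) (identity (qx - qy)) (ℤP.i<j⇒suc[i]≤j d))
  where
  identity : ∀ t → + 1 + (t - + 1) ≡ t
  identity = solve-∀

diffTerm<0⇒residue< : ∀ s s′ → diffTerm (+ 0 , s) (+ 0 , s′) ℤ.< + 0 → s ℤ.< s′
diffTerm<0⇒residue< s s′ d with s ℤP.<? s′
... | yes s<s′ = s<s′
... | no  s≮s′ = ⊥-elim (ℤP.<-irrefl refl
      (subst (λ m → + 0 - m ℤ.< + 0) (negInd-nonneg (ℤP.i≤j⇒0≤j-i (ℤP.≮⇒≥ s≮s′))) d))

Ascending⇒levels-zero : ∀ x xs → Ascending (x ∷ xs) → + 0 ℤ.≤ proj₁ x → proj₁ (lastOf x xs) ℤ.≤ + 0 →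
  All (λ z → proj₁ z ≡ + 0) (x ∷ xs)
Ascending⇒levels-zero x []       _             0≤q q≤0 = ℤP.≤-antisym q≤0 0≤q ∷ []
Ascending⇒levels-zero x (y ∷ ys) (d ∷ asc)     0≤q q≤0
  with Ascending⇒levels-zero y ys asc (ℤP.≤-trans 0≤q (diffTerm<0⇒level≤ x y d)) q≤0
... | qy≡0 ∷ rest =
  ℤP.≤-antisym (ℤP.≤-trans (diffTerm<0⇒level≤ x y d) (ℤP.≤-reflexive qy≡0)) 0≤q ∷ qy≡0 ∷ rest

Ascending-tight : ∀ k b x xs → + k ℤ.≤ proj₂ x → Ascending (x ∷ xs) →
  All (λ z → proj₁ z ≡ + 0) (x ∷ xs) → All (λ z → proj₂ z ℤ.≤ + b) (x ∷ xs) →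
  k ℕ.+ length (x ∷ xs) ℕ.≤ suc b ×
  (k ℕ.+ length (x ∷ xs) ≡ suc b → x ∷ xs ≡ identityFrom k (length (x ∷ xs)))
Ascending-tight k b (_ , s) [] k≤s _ (refl ∷ []) (s≤b ∷ []) = bound , exact
  where
  k≤b : k ℕ.≤ b
  k≤b = ℤP.drop‿+≤+ (ℤP.≤-trans k≤s s≤b)
  bound : k ℕ.+ 1 ℕ.≤ suc b
  bound = subst (ℕ._≤ suc b) (ℕP.+-comm 1 k) (ℕ.s≤s k≤b)
  exact : k ℕ.+ 1 ≡ suc b → (+ 0 , s) ∷ [] ≡ (+ 0 , + k) ∷ []
  exact e = cong (λ t → (+ 0 , t) ∷ [])
    (ℤP.≤-antisym (ℤP.≤-trans s≤b (ℤP.≤-reflexive (cong +_ (ℕP.suc-injective (trans (sym e) (ℕP.+-comm k 1)))))) k≤s)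
Ascending-tight k b (_ , s) ((_ , s′) ∷ ys) k≤s (d ∷ asc) (refl ∷ refl ∷ levels) (_ ∷ bs)
  with diffTerm<0⇒residue< s s′ d
... | s<s′ with Ascending-tight (suc k) b (+ 0 , s′) ys (ℤP.i<j⇒suc[i]≤j (ℤP.≤-<-trans k≤s s<s′)) asc (refl ∷ levels) bs
... | bound , exact = subst (ℕ._≤ suc b) (sym shift) bound , exact′
  where
  shift = ℕP.+-suc k (length ((+ 0 , s′) ∷ ys))
  exact′ : _ → (+ 0 , s) ∷ (+ 0 , s′) ∷ ys ≡ identityFrom k (length ((+ 0 , s) ∷ (+ 0 , s′) ∷ ys))
  exact′ e with exact (trans (sym shift) e)
  ... | rest = cong₂ _∷_ (cong (λ t → (+ 0 , t)) s≡k) rest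
    where
    s′≡k+1 : s′ ≡ + suc k
    s′≡k+1 = cong proj₂ (∷-injectiveˡ rest)
    s≡k : s ≡ + k
    s≡k = ℤP.≤-antisym (ℤP.i<j⇒i≤pred[j] (subst (s ℤ.<_) s′≡k+1 s<s′)) k≤s

ascending-or-descent : ∀ l →
  (∃[ i ] suc i ℕ.< length l × + 0 ℤ.≤ diffTerm (nth l i) (nth l (suc i))) ⊎ Ascending l
ascending-or-descent []           = inj₂ []
ascending-or-descent (x ∷ [])     = inj₂ [-]
ascending-or-descent (x ∷ y ∷ ys) with + 0 ℤ.≤? diffTerm x y | ascending-or-descent (y ∷ ys)
... | yes 0≤d | _                       = inj₁ (0 , ℕ.s≤s (ℕ.s≤s ℕ.z≤n) , 0≤d)
... | no  0≰d | inj₁ (i , i+1<∣l∣ , 0≤d) = inj₁ (suc i , ℕ.s≤s i+1<∣l∣ , 0≤d)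
... | no  0≰d | inj₂ asc               = inj₂ (ℤP.≰⇒> 0≰d ∷ asc)

residue≤ : ∀ {s b} → ∣ s ∣ ℕ.≤ b → s ℤ.≤ + b
residue≤ {+ _}      ∣s∣≤b = ℤ.+≤+ ∣s∣≤b
residue≤ { -[1+ _ ]} _    = ℤ.-≤+

head-residue≥1 : ∀ {n} x → proj₁ x ≡ + 0 → + 0 ℤ.≤ selfTerm x → Bounded n x → + 1 ℤ.≤ proj₂ x
head-residue≥1 (_ , + _)      refl _  (1≤t , _) = ℤ.+≤+ 1≤t
head-residue≥1 (_ , -[1+ _ ]) refl () _

-- If none of s₀, sₙ, sᵢ lowers ℓ, the window has level 0 throughout and strictly increasing
-- positive residues bounded by n, so it is the identity.
descent : ∀ n l → Valid n l → l ≡ identityWindow n ⊎ ∃[ a ] suc (inversions (act n a l)) ≡ inversions l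
descent zero    []       _ = inj₁ refl
descent (suc m) (x ∷ xs) (∣l∣ , bl@(bx ∷ _) , al@(x#xs ∷ _)) with + 0 ℤ.≤? selfTerm x
... | no 0≰t = inj₂ (Fin.zero , negateHead-down x xs x#xs (Bounded≢0 x bx) (ℤP.≰⇒> 0≰t))
... | yes 0≤t with + 0 ℤ.≤? - selfTerm (lastOf x xs)
...   | no 0≰t′ = inj₂ (Fin.fromℕ (suc m) ,
        trans (cong (suc ∘ inversions) (act-last m (Fin.fromℕ (suc m)) (x ∷ xs) (FinP.toℕ-fromℕ (suc m))))
              (reflectLast-down x xs (Bounded≢0 (lastOf x xs) (All-lastOf x xs bl)) (ℤP.≰⇒> 0≰t′)))
...   | yes 0≤t′ with ascending-or-descent (x ∷ xs)
...     | inj₁ (i , i+1<∣l∣ , 0≤d) = inj₂ (Fin.fromℕ< i+1<n+1 ,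
          trans (cong (suc ∘ inversions) (act-middle (suc m) _ i (x ∷ xs) (FinP.toℕ-fromℕ< i+1<n+1) i+1<n))
                (swapAt-down i (x ∷ xs) al i+1<∣l∣ 0≤d))
  where
  i+1<n = subst (suc i ℕ.<_) ∣l∣ i+1<∣l∣
  i+1<n+1 = ℕP.m<n⇒m<1+n i+1<n
...     | inj₂ asc = inj₁ (trans (proj₂ tight (cong suc ∣l∣)) (cong (identityFrom 1) ∣l∣))
  where
  levels = Ascending⇒levels-zero x xs asc (level≥0 x 0≤t) (level≤0 (lastOf x xs) 0≤t′)
  tight = Ascending-tight 1 (suc m) x xs (head-residue≥1 x (All.head levels) 0≤t bx) asc levels
                          (All.map (residue≤ ∘ proj₂) bl)

word-reaching : ∀ n m l → Valid n l → inversions l ≡ m →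
  ∃[ ρ ] actWord n (identityWindow n) ρ ≡ l × length ρ ≡ m
word-reaching n m l v ℓ≡m with descent n l v
... | inj₁ refl = [] , refl , trans (sym (inversions-identityFrom 1 n)) ℓ≡m
word-reaching n zero    l v ℓ≡m | inj₂ (a , down) with () ← trans down ℓ≡m
word-reaching n (suc m) l v ℓ≡m | inj₂ (a , down)
  with word-reaching n m (act n a l) (Valid-act n a v) (ℕP.suc-injective (trans down ℓ≡m))
... | ρ , reach , ∣ρ∣≡m =
  ρ ++ a ∷ [] ,
  trans (foldl-++ (λ l′ b → act n b l′) (identityWindow n) ρ (a ∷ []))
        (trans (cong (act n a) reach) (act-involutive n a l)) ,
  trans (length-++ ρ) (trans (ℕP.+-comm (length ρ) 1) (cong suc ∣ρ∣≡m))

-- The windows of a word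

Nℤ : ℕ → ℤ
Nℤ n = + Nmod n

extResidue : ∀ {n} → (Fin n → ℤ) → ℕ → ℤ
extResidue {n} w r =
  if r ℕ.≡ᵇ 0 then + 0
  else if r ℕ.≤ᵇ n then winAt w r
  else if r ℕ.≡ᵇ suc n then + suc n
  else Nℤ n - winAt w (Nmod n ℕ.∸ r)

ext-residue : ∀ {n} (w : Fin n → ℤ) x → ext w x ≡ (x /ℕ Nmod n) * Nℤ n + extResidue w (x %ℕ Nmod n)
ext-residue {n} w x = push-base (r ℕ.≡ᵇ 0) (r ℕ.≤ᵇ n) (r ℕ.≡ᵇ suc n)
  where
  r = x %ℕ Nmod n
  base = (x /ℕ Nmod n) * Nℤ n
  push-base : ∀ b₁ b₂ b₃ →
    (if b₁ then base else if b₂ then base + winAt w r else if b₃ then base + + suc n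
     else base + Nℤ n - winAt w (Nmod n ℕ.∸ r))
    ≡ base + (if b₁ then + 0 else if b₂ then winAt w r else if b₃ then + suc n
              else Nℤ n - winAt w (Nmod n ℕ.∸ r))
  push-base true  _     _     = sym (ℤP.+-identityʳ base)
  push-base false true  _     = refl
  push-base false false true  = refl
  push-base false false false = ℤP.+-assoc base (Nℤ n) (- winAt w (Nmod n ℕ.∸ r))

ext-at : ∀ {n} (w : Fin n → ℤ) q r → r ℕ.< Nmod n → ext w (+ r + q * Nℤ n) ≡ q * Nℤ n + extResidue w r
ext-at {n} w q r r<N with divMod-of (Nmod n) q r r<N
... | quot , rem = trans (ext-residue w (+ r + q * Nℤ n)) (cong₂ (λ a b → a * Nℤ n + extResidue w b) quot rem)

extResidue-window : ∀ {n} (w : Fin n → ℤ) r → 1 ℕ.≤ r → r ℕ.≤ n → extResidue w r ≡ winAt w r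
extResidue-window w (suc r) _ r<n rewrite ≤ᵇ-true r<n = refl

extResidue-middle : ∀ {n} (w : Fin n → ℤ) → extResidue w (suc n) ≡ + suc n
extResidue-middle {n} w rewrite ≤ᵇ-false (ℕP.n<1+n n) | ≡ᵇ-true {n} refl = refl

extResidue-upper : ∀ {n} (w : Fin n → ℤ) r → suc (suc n) ℕ.≤ r → extResidue w r ≡ Nℤ n - winAt w (Nmod n ℕ.∸ r)
extResidue-upper {n} w (suc r) (ℕ.s≤s n<r) rewrite ≤ᵇ-false {suc r} {n} (ℕP.<⇒≤ (ℕ.s≤s n<r)) | ≡ᵇ-false (ℕP.<⇒≢ n<r ∘ sym) = refl

extResidue-reflect : ∀ {n} (w : Fin n → ℤ) r → 1 ℕ.≤ r → r ℕ.< Nmod n →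
  extResidue w (Nmod n ℕ.∸ r) ≡ Nℤ n - extResidue w r
extResidue-reflect {n} w r 1≤r r<N with ℕP.<-cmp r (suc n)
... | tri< r≤n _ _ = begin
    extResidue w (Nmod n ℕ.∸ r)                    ≡⟨ extResidue-upper w (Nmod n ℕ.∸ r) n+2≤N-r ⟩
    Nℤ n - winAt w (Nmod n ℕ.∸ (Nmod n ℕ.∸ r))     ≡⟨ cong (λ t → Nℤ n - winAt w t) (ℕP.m∸[m∸n]≡n (ℕP.<⇒≤ r<N)) ⟩
    Nℤ n - winAt w r                               ≡⟨ cong (_-_ (Nℤ n)) (extResidue-window w r 1≤r (ℕP.≤-pred r≤n)) ⟨
    Nℤ n - extResidue w r                          ∎
  where
  open ≡-Reasoning
  n+2≤N-r : suc (suc n) ℕ.≤ Nmod n ℕ.∸ r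
  n+2≤N-r = subst (ℕ._≤ Nmod n ℕ.∸ r) (trans (cong (ℕ._∸ n) (Nmod≡ n)) (ℕP.m+n∸n≡m (suc (suc n)) n))
                  (ℕP.∸-monoʳ-≤ (Nmod n) (ℕP.≤-pred r≤n))
... | tri≈ _ refl _ = begin
    extResidue w (Nmod n ℕ.∸ suc n)  ≡⟨ cong (extResidue w) N-[n+1]≡n+1 ⟩
    extResidue w (suc n)             ≡⟨ extResidue-middle w ⟩
    + suc n                          ≡⟨ cancel (+ suc n) ⟨
    (+ suc n + + suc n) - + suc n    ≡⟨ cong (λ m → m - + suc n) (ℤP.pos-+ (suc n) (suc n)) ⟨
    + (suc n ℕ.+ suc n) - + suc n    ≡⟨ cong (λ m → + m - + suc n) (Nmod≡2[n+1] n) ⟨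
    Nℤ n - + suc n                   ≡⟨ cong (_-_ (Nℤ n)) (extResidue-middle w) ⟨
    Nℤ n - extResidue w (suc n)      ∎
  where
  open ≡-Reasoning
  cancel : ∀ a → (a + a) - a ≡ a
  cancel = solve-∀
  N-[n+1]≡n+1 : Nmod n ℕ.∸ suc n ≡ suc n
  N-[n+1]≡n+1 = trans (cong (ℕ._∸ suc n) (Nmod≡2[n+1] n)) (ℕP.m+n∸n≡m (suc n) (suc n))
... | tri> _ _ n+1<r = begin
    extResidue w (Nmod n ℕ.∸ r)                    ≡⟨ extResidue-window w (Nmod n ℕ.∸ r) (ℕP.m<n⇒0<n∸m r<N) N-r≤n ⟩
    winAt w (Nmod n ℕ.∸ r)                         ≡⟨ cancel (Nℤ n) (winAt w (Nmod n ℕ.∸ r)) ⟨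
    Nℤ n - (Nℤ n - winAt w (Nmod n ℕ.∸ r))         ≡⟨ cong (_-_ (Nℤ n)) (extResidue-upper w r n+1<r) ⟨
    Nℤ n - extResidue w r                          ∎
  where
  open ≡-Reasoning
  cancel : ∀ m t → m - (m - t) ≡ t
  cancel = solve-∀
  N-r≤n : Nmod n ℕ.∸ r ℕ.≤ n
  N-r≤n = subst (Nmod n ℕ.∸ r ℕ.≤_) (trans (cong (ℕ._∸ suc (suc n)) (Nmod≡ n)) (ℕP.m+n∸m≡n (suc (suc n)) n))
                (ℕP.∸-monoʳ-≤ (Nmod n) n+1<r)

ext-reflect : ∀ {n} (w : Fin n → ℤ) k x → ext w (k * Nℤ n - x) ≡ k * Nℤ n - ext w x
ext-reflect {n} w k x =
  reflect-at (x %ℕ Nmod n) (DivMod.n%ℕd<d x (Nmod n)) (DivMod.a≡a%ℕn+[a/ℕn]*n x (Nmod n)) (ext-residue w x)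
  where
  M = Nℤ n
  q = x /ℕ Nmod n
  reflect-at : ∀ r → r ℕ.< Nmod n → x ≡ + r + q * M → ext w x ≡ q * M + extResidue w r →
    ext w (k * M - x) ≡ k * M - ext w x
  reflect-at zero 0<N x≡ ext≡ = begin
    ext w (k * M - x)                 ≡⟨ cong (λ y → ext w (k * M - y)) x≡ ⟩
    ext w (k * M - (+ 0 + q * M))     ≡⟨ cong (ext w) (regroup k q M) ⟩
    ext w (+ 0 + (k - q) * M)         ≡⟨ ext-at w (k - q) 0 0<N ⟩
    (k - q) * M + + 0                 ≡⟨ ungroup k q M ⟩
    k * M - (q * M + + 0)             ≡⟨ cong (_-_ (k * M)) ext≡ ⟨
    k * M - ext w x                   ∎
    where
    open ≡-Reasoning
    regroup : ∀ k q M → k * M - (+ 0 + q * M) ≡ + 0 + (k - q) * M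
    regroup = solve-∀
    ungroup : ∀ k q M → (k - q) * M + + 0 ≡ k * M - (q * M + + 0)
    ungroup = solve-∀
  reflect-at (suc d) r<N x≡ ext≡ = begin
    ext w (k * M - x)                                        ≡⟨ cong (λ y → ext w (k * M - y)) x≡ ⟩
    ext w (k * M - (+ suc d + q * M))                        ≡⟨ cong (ext w) (regroup k q M (+ suc d)) ⟩
    ext w ((M - + suc d) + (k - q - + 1) * M)                ≡⟨ cong (λ t → ext w (t + (k - q - + 1) * M)) N-r ⟨
    ext w (+ (Nmod n ℕ.∸ suc d) + (k - q - + 1) * M)         ≡⟨ ext-at w (k - q - + 1) (Nmod n ℕ.∸ suc d) N-r<N ⟩
    (k - q - + 1) * M + extResidue w (Nmod n ℕ.∸ suc d)      ≡⟨ cong (_+_ ((k - q - + 1) * M))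
                                                                      (extResidue-reflect w (suc d) (ℕ.s≤s ℕ.z≤n) r<N) ⟩
    (k - q - + 1) * M + (M - extResidue w (suc d))           ≡⟨ ungroup k q M (extResidue w (suc d)) ⟩
    k * M - (q * M + extResidue w (suc d))                   ≡⟨ cong (_-_ (k * M)) ext≡ ⟨
    k * M - ext w x                                          ∎
    where
    open ≡-Reasoning
    N-r = +[m∸k]≡+m-+k (ℕP.<⇒≤ r<N)
    N-r<N = ℕP.∸-monoʳ-< {Nmod n} {suc d} {0} (ℕ.s≤s ℕ.z≤n) (ℕP.<⇒≤ r<N)
    regroup : ∀ k q M R → k * M - (R + q * M) ≡ (M - R) + (k - q - + 1) * M
    regroup = solve-∀
    ungroup : ∀ k q M T → (k - q - + 1) * M + (M - T) ≡ k * M - (q * M + T)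
    ungroup = solve-∀

Equivariant : ℕ → (ℤ → ℤ) → Set
Equivariant n P = ∀ k x → P (k * Nℤ n - x) ≡ k * Nℤ n - P x

Equivariant-∘gen : ∀ {n P} (a : Fin (suc n)) → Equivariant n P → Equivariant n (P ∘ gen a)
Equivariant-∘gen {P = P} a P-equivariant k x = trans (cong P (ext-reflect (genWin a) k x)) (P-equivariant k _)

value : ℕ → Entry → ℤ
value n (q , s) = q * Nℤ n + s

value-negate : ∀ n x → value n (negate x) ≡ - value n x
value-negate n (q , s) = identity q s (Nℤ n)
  where
  identity : ∀ q s M → (- q) * M + (- s) ≡ - (q * M + s)
  identity = solve-∀

value-reflect : ∀ n x → value n (reflect x) ≡ + 1 * Nℤ n - value n x
value-reflect n (q , s) = identity q s (Nℤ n)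
  where
  identity : ∀ q s M → (+ 1 - q) * M + (- s) ≡ + 1 * M - (q * M + s)
  identity = solve-∀

n+2≡N-n : ∀ n → + suc (suc n) ≡ + 1 * Nℤ n - + n
n+2≡N-n n = sym (begin
  + 1 * Nℤ n - + n            ≡⟨ cong (_- + n) (ℤP.*-identityˡ (Nℤ n)) ⟩
  + Nmod n - + n              ≡⟨ +[m∸k]≡+m-+k n≤N ⟨
  + (Nmod n ℕ.∸ n)            ≡⟨ cong (λ m → + (m ℕ.∸ n)) (Nmod≡ n) ⟩
  + (suc (suc n) ℕ.+ n ℕ.∸ n) ≡⟨ cong +_ (ℕP.m+n∸n≡m (suc (suc n)) n) ⟩
  + suc (suc n)               ∎)
  where
  open ≡-Reasoning
  n≤N : n ℕ.≤ Nmod n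
  n≤N = subst (n ℕ.≤_) (sym (Nmod≡ n)) (ℕP.m≤n+m n (suc (suc n)))

HasWindow : ℕ → (ℤ → ℤ) → Window → Set
HasWindow n P W = ∀ j → j ℕ.< n → P (+ suc j) ≡ value n (nth W j)

-- The body of genWin with its two tests on the index abstracted, so that they can be matched on.
genValue : (first last : Bool) (n i p : ℕ) → ℤ
genValue first last n i p =
  if first then (if p ℕ.≡ᵇ 1 then - (+ 1) else + p)
  else if last then (if p ℕ.≡ᵇ n then + (suc (suc n)) else + p)
  else if p ℕ.≡ᵇ i then + (suc i)
  else if p ℕ.≡ᵇ suc i then + i
  else + p

winAt-lookup : ∀ {n} (w : Fin n → ℤ) j (j<n : j ℕ.< n) → winAt w (suc j) ≡ w (Fin.fromℕ< j<n)
winAt-lookup {suc n}       w zero    _            = refl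
winAt-lookup {suc (suc n)} w (suc j) (ℕ.s≤s j<n) = winAt-lookup (w ∘ Fin.suc) j j<n

gen-window : ∀ {n} (a : Fin (suc n)) j → j ℕ.< n →
  gen a (+ suc j) ≡ genValue (toℕ a ℕ.≡ᵇ 0) (toℕ a ℕ.≡ᵇ n) n (toℕ a) (suc j)
gen-window {n} a j j<n = begin
  ext (genWin a) (+ suc j)                          ≡⟨ cong (ext (genWin a)) (ℤP.+-identityʳ (+ suc j)) ⟨
  ext (genWin a) (+ suc j + + 0 * Nℤ n)             ≡⟨ ext-at (genWin a) (+ 0) (suc j) j+1<N ⟩
  + 0 * Nℤ n + extResidue (genWin a) (suc j)        ≡⟨ ℤP.+-identityˡ _ ⟩
  extResidue (genWin a) (suc j)                     ≡⟨ extResidue-window (genWin a) (suc j) (ℕ.s≤s ℕ.z≤n) j<n ⟩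
  winAt (genWin a) (suc j)                          ≡⟨ winAt-lookup (genWin a) j j<n ⟩
  genWin a (Fin.fromℕ< j<n)                         ≡⟨ cong (genValue (toℕ a ℕ.≡ᵇ 0) (toℕ a ℕ.≡ᵇ n) n (toℕ a) ∘ suc)
                                                             (FinP.toℕ-fromℕ< j<n) ⟩
  genValue (toℕ a ℕ.≡ᵇ 0) (toℕ a ℕ.≡ᵇ n) n (toℕ a) (suc j) ∎
  where
  open ≡-Reasoning
  j+1<N : suc j ℕ.< Nmod n
  j+1<N = ℕ.s≤s (ℕP.≤-trans j<n (ℕP.≤-trans (ℕP.m≤m+n n (n ℕ.+ 0)) (ℕP.n≤1+n _)))

nth-mapLast-last : ∀ f W j → suc j ≡ length W → nth (mapLast f W) j ≡ f (nth W j)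
nth-mapLast-last f (x ∷ [])     zero    _ = refl
nth-mapLast-last f (x ∷ y ∷ ys) (suc j) e = nth-mapLast-last f (y ∷ ys) j (ℕP.suc-injective e)

nth-mapLast-other : ∀ f W j → suc j ℕ.< length W → nth (mapLast f W) j ≡ nth W j
nth-mapLast-other f (x ∷ [])     _       (ℕ.s≤s ())
nth-mapLast-other f (x ∷ y ∷ ys) zero    _             = refl
nth-mapLast-other f (x ∷ y ∷ ys) (suc j) (ℕ.s≤s j<∣W∣) = nth-mapLast-other f (y ∷ ys) j j<∣W∣

nth-swapAt-left : ∀ i W → suc i ℕ.< length W → nth (swapAt i W) i ≡ nth W (suc i)
nth-swapAt-left zero    (x ∷ [])    (ℕ.s≤s ())
nth-swapAt-left zero    (x ∷ y ∷ W) _             = refl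
nth-swapAt-left (suc i) (x ∷ W)     (ℕ.s≤s i<∣W∣) = nth-swapAt-left i W i<∣W∣

nth-swapAt-right : ∀ i W → suc i ℕ.< length W → nth (swapAt i W) (suc i) ≡ nth W i
nth-swapAt-right zero    (x ∷ [])    (ℕ.s≤s ())
nth-swapAt-right zero    (x ∷ y ∷ W) _             = refl
nth-swapAt-right (suc i) (x ∷ W)     (ℕ.s≤s i<∣W∣) = nth-swapAt-right i W i<∣W∣

nth-swapAt-other : ∀ i W j → j ≢ i → j ≢ suc i → nth (swapAt i W) j ≡ nth W j
nth-swapAt-other zero    []          _             _   _     = refl
nth-swapAt-other zero    (x ∷ [])    _             _   _     = refl
nth-swapAt-other zero    (x ∷ y ∷ W) zero          j≢0 _     = ⊥-elim (j≢0 refl)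
nth-swapAt-other zero    (x ∷ y ∷ W) (suc zero)    _   j≢1   = ⊥-elim (j≢1 refl)
nth-swapAt-other zero    (x ∷ y ∷ W) (suc (suc j)) _   _     = refl
nth-swapAt-other (suc i) []          _             _   _     = refl
nth-swapAt-other (suc i) (x ∷ W)     zero          _   _     = refl
nth-swapAt-other (suc i) (x ∷ W)     (suc j)       j≢i j≢i+1 =
  nth-swapAt-other i W j (j≢i ∘ cong suc) (j≢i+1 ∘ cong suc)

-- Besides the values at 1, …, n, right multiplication by s₀ and sₙ reads P(−1) = −P(1) and
-- P(n+2) = N − P(n), which equivariance supplies.
module _ {n} {P : ℤ → ℤ} (P-equivariant : Equivariant n P) where

  HasWindow-actOn : ∀ first last i W → HasWindow n P W → length W ≡ n →
    (i ℕ.≡ᵇ 0) ≡ first → (i ℕ.≡ᵇ n) ≡ last → i ℕ.≤ n →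
    ∀ j → j ℕ.< n → P (genValue first last n i (suc j)) ≡ value n (nth (actOn first last i W) j)
  HasWindow-actOn true _ _ (x ∷ _) window _ _ _ _ zero 0<n = begin
    P (+ 0 * Nℤ n - + 1)          ≡⟨ P-equivariant (+ 0) (+ 1) ⟩
    + 0 * Nℤ n - P (+ 1)          ≡⟨ ℤP.+-identityˡ _ ⟩
    - P (+ 1)                     ≡⟨ cong -_ (window 0 0<n) ⟩
    - value n x                   ≡⟨ value-negate n x ⟨
    value n (negate x)            ∎
    where open ≡-Reasoning
  HasWindow-actOn true _ _ (_ ∷ _) window _ _ _ _ (suc j) j<n = window (suc j) j<n
  HasWindow-actOn true _ _ [] _ refl _ _ _ _ ()
  HasWindow-actOn false true _ W window ∣W∣ _ _ _ j j<n with suc j ℕ.≟ n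
  ... | yes j+1≡n rewrite ≡ᵇ-true j+1≡n = begin
    P (+ suc (suc n))             ≡⟨ cong P (n+2≡N-n n) ⟩
    P (+ 1 * Nℤ n - + n)          ≡⟨ P-equivariant (+ 1) (+ n) ⟩
    + 1 * Nℤ n - P (+ n)          ≡⟨ cong (λ m → + 1 * Nℤ n - P (+ m)) j+1≡n ⟨
    + 1 * Nℤ n - P (+ suc j)      ≡⟨ cong (_-_ (+ 1 * Nℤ n)) (window j j<n) ⟩
    + 1 * Nℤ n - value n (nth W j) ≡⟨ value-reflect n (nth W j) ⟨
    value n (reflect (nth W j))   ≡⟨ cong (value n) (nth-mapLast-last reflect W j (trans j+1≡n (sym ∣W∣))) ⟨
    value n (nth (mapLast reflect W) j) ∎
    where open ≡-Reasoning
  ... | no j+1≢n rewrite ≡ᵇ-false j+1≢n =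
    trans (window j j<n) (cong (value n) (sym (nth-mapLast-other reflect W j
      (subst (suc j ℕ.<_) (sym ∣W∣) (ℕP.≤∧≢⇒< j<n j+1≢n)))))
  HasWindow-actOn false false zero _ _ _ ()
  HasWindow-actOn false false (suc i) W window ∣W∣ _ i+1≢n i+1≤n j j<n with j ℕ.≟ i
  ... | yes refl rewrite ≡ᵇ-true {j} refl =
    trans (window (suc j) i+1<n) (cong (value n) (sym (nth-swapAt-left j W (subst (suc j ℕ.<_) (sym ∣W∣) i+1<n))))
    where i+1<n = ℕP.≤∧≢⇒< i+1≤n (≡ᵇ-false⇒≢ (suc j) n i+1≢n)
  ... | no j≢i rewrite ≡ᵇ-false (j≢i ∘ ℕP.suc-injective) with j ℕ.≟ suc i
  ...   | yes refl rewrite ≡ᵇ-true {i} refl =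
    trans (window i (ℕP.<-trans (ℕP.n<1+n i) j<n))
          (cong (value n) (sym (nth-swapAt-right i W (subst (suc i ℕ.<_) (sym ∣W∣) j<n))))
  ...   | no j≢i+1 rewrite ≡ᵇ-false (j≢i+1 ∘ ℕP.suc-injective) =
    trans (window j j<n) (cong (value n) (sym (nth-swapAt-other i W j j≢i j≢i+1)))

  HasWindow-act : ∀ a W → HasWindow n P W → length W ≡ n → HasWindow n (P ∘ gen a) (act n a W)
  HasWindow-act a W window ∣W∣ j j<n =
    trans (cong P (gen-window a j j<n))
          (HasWindow-actOn (toℕ a ℕ.≡ᵇ 0) (toℕ a ℕ.≡ᵇ n) (toℕ a) W window ∣W∣ refl refl (ℕP.≤-pred (FinP.toℕ<n a)) j j<n)

HasWindow-actWord : ∀ n ρ {P W} → Equivariant n P → HasWindow n P W → Valid n W →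
  HasWindow n (P ∘ evalWord ρ) (actWord n W ρ)
HasWindow-actWord n []      _             window _ = window
HasWindow-actWord n (a ∷ ρ) {W = W} P-equivariant window v =
  HasWindow-actWord n ρ (Equivariant-∘gen a P-equivariant) (HasWindow-act P-equivariant a W window (proj₁ v))
                    (Valid-act n a v)

HasWindow-evalWord : ∀ n ρ → HasWindow n (evalWord ρ) (actWord n (identityWindow n) ρ)
HasWindow-evalWord n ρ = HasWindow-actWord n ρ {P = λ x → x} (λ _ _ → refl) identity (Valid-identityWindow n)
  where
  identity : HasWindow n (λ x → x) (identityWindow n)
  identity j j<n = cong (value n) (sym (nth-identityFrom 1 n j j<n))

inversions≤length : ∀ n ρ {l} → actWord n (identityWindow n) ρ ≡ l → inversions l ℕ.≤ length ρ
inversions≤length n ρ refl =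
  subst (λ t → inversions (actWord n (identityWindow n) ρ) ℕ.≤ t ℕ.+ length ρ) (inversions-identityFrom 1 n)
        (inversions-actWord-≤ n ρ (Valid-identityWindow n))

countSn-shortest : ∀ n ρ {l} → actWord n (identityWindow n) ρ ≡ l → length ρ ℕ.≤ inversions l → countSn ρ ≡ levelSum l
countSn-shortest n ρ refl shortest = begin
  countSn ρ                         ≡⟨ cong (ℕ._+ countSn ρ) (levelSum-identityFrom 1 n) ⟨
  levelSum id ℕ.+ countSn ρ         ≡⟨ levelSum-actWord n ρ (Valid-identityWindow n) tight ⟨
  levelSum (actWord n id ρ)         ∎
  where
  open ≡-Reasoning
  id = identityWindow n
  tight : inversions (actWord n id ρ) ≡ inversions id ℕ.+ length ρ
  tight = trans (ℕP.≤-antisym (inversions≤length n ρ refl) shortest)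
                (cong (ℕ._+ length ρ) (sym (inversions-identityFrom 1 n)))

value-injective : ∀ n {x y} → Bounded n x → Bounded n y → value n x ≡ value n y → x ≡ y
value-injective n {q , s} {q′ , s′} (_ , ∣s∣≤n) (_ , ∣s′∣≤n) e = cong₂ _,_ q≡q′ s≡s′
  where
  ∣s′-s∣<N : ∣ s′ - s ∣ ℕ.< Nmod n
  ∣s′-s∣<N = ℕ.s≤s (ℕP.≤-trans (ℤP.∣i-j∣≤∣i∣+∣j∣ s′ s)
                   (ℕP.≤-trans (ℕP.+-mono-≤ ∣s′∣≤n ∣s∣≤n) (ℕP.≤-trans (ℕP.+-monoʳ-≤ n (ℕP.m≤m+n n 0)) (ℕP.n≤1+n _))))
  q≡q′ = proj₁ (euclid-unique (Nmod n) q q′ s s′ ∣s′-s∣<N e)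
  s≡s′ = proj₂ (euclid-unique (Nmod n) q q′ s s′ ∣s′-s∣<N e)

nth-ext : ∀ R S → length R ≡ length S → (∀ j → j ℕ.< length R → nth R j ≡ nth S j) → R ≡ S
nth-ext []      []      _ _       = refl
nth-ext (x ∷ R) (y ∷ S) e same = cong₂ _∷_ (same 0 (ℕ.s≤s ℕ.z≤n)) (nth-ext R S (ℕP.suc-injective e) (λ j j<∣R∣ → same (suc j) (ℕ.s≤s j<∣R∣)))

All-nth : ∀ {P : Entry → Set} R j → All P R → j ℕ.< length R → P (nth R j)
All-nth (x ∷ R) zero    (px ∷ _)   _            = px
All-nth (x ∷ R) (suc j) (_ ∷ pR)   (ℕ.s≤s j<∣R∣) = All-nth R j pR j<∣R∣

nth-tabulate : ∀ {n} (f : Fin n → Entry) k → nth (tabulate f) (toℕ k) ≡ f k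
nth-tabulate f Fin.zero    = refl
nth-tabulate f (Fin.suc k) = nth-tabulate (f ∘ Fin.suc) k

module _ {n : ℕ} {w c σ : Fin n → ℤ} (w≡ : ∀ k → w k ≡ c k * Nℤ n + σ k)
         (bounded : ∀ k → Bounded n (c k , σ k)) (σ-injective : Injective _≡_ _≡_ (λ k → ∣ σ k ∣)) where

  private
    W : Window
    W = tabulate (λ k → (c k , σ k))

    ∣W∣ : length W ≡ n
    ∣W∣ = length-tabulate _

  Valid-window : Valid n W
  Valid-window = ∣W∣ , AllP.tabulate⁺ bounded , AllPairsP.tabulate⁺ (λ i≢j → i≢j ∘ σ-injective)

  reaches⇒represents : ∀ ρ → actWord n (identityWindow n) ρ ≡ W → Represents ρ w
  reaches⇒represents ρ reach k = begin
    evalWord ρ (+ suc (toℕ k))                                   ≡⟨ HasWindow-evalWord n ρ (toℕ k) (FinP.toℕ<n k) ⟩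
    value n (nth (actWord n (identityWindow n) ρ) (toℕ k))       ≡⟨ cong (λ R → value n (nth R (toℕ k))) reach ⟩
    value n (nth W (toℕ k))                                      ≡⟨ cong (value n) (nth-tabulate _ k) ⟩
    c k * Nℤ n + σ k                                             ≡⟨ w≡ k ⟨
    w k                                                          ∎
    where open ≡-Reasoning

  represents⇒reaches : ∀ ρ → Represents ρ w → actWord n (identityWindow n) ρ ≡ W
  represents⇒reaches ρ represents = nth-ext R W (trans ∣R∣ (sym ∣W∣)) same-entry
    where
    R = actWord n (identityWindow n) ρ
    vR = Valid-actWord n ρ (Valid-identityWindow n)
    ∣R∣ = proj₁ vR
    same-entry : ∀ j → j ℕ.< length R → nth R j ≡ nth W j
    same-entry j j<∣R∣ = value-injective n (All-nth R j (proj₁ (proj₂ vR)) j<∣R∣)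
                                           (All-nth W j (proj₁ (proj₂ Valid-window)) (subst (j ℕ.<_) (sym ∣W∣) j<n))
                                           same-value
      where
      j<n = subst (j ℕ.<_) ∣R∣ j<∣R∣
      k = Fin.fromℕ< j<n
      same-value : value n (nth R j) ≡ value n (nth W j)
      same-value = begin
        value n (nth R j)            ≡⟨ HasWindow-evalWord n ρ j j<n ⟨
        evalWord ρ (+ suc j)         ≡⟨ cong (λ t → evalWord ρ (+ suc t)) (FinP.toℕ-fromℕ< j<n) ⟨
        evalWord ρ (+ suc (toℕ k))   ≡⟨ represents k ⟩
        w k                          ≡⟨ w≡ k ⟩
        value n (c k , σ k)          ≡⟨ cong (value n) (nth-tabulate _ k) ⟨
        value n (nth W (toℕ k))      ≡⟨ cong (λ t → value n (nth W t)) (FinP.toℕ-fromℕ< j<n) ⟩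
        value n (nth W j)            ∎
        where open ≡-Reasoning

level≥0-of-positive : ∀ n q s → ∣ s ∣ ℕ.≤ n → + 0 ℤ.< q * Nℤ n + s → + 0 ℤ.≤ q
level≥0-of-positive n (+ _)     _          _     _  = ℤ.+≤+ ℕ.z≤n
level≥0-of-positive n -[1+ a ] -[1+ _ ]   _     ()
level≥0-of-positive n -[1+ a ] (+ t)      t≤n   0<value =
  ⊥-elim (ℤP.<-asym 0<value (⊖<0 t<[a+1]N))
  where
  t<[a+1]N : t ℕ.< suc a ℕ.* Nmod n
  t<[a+1]N = ℕ.s≤s (ℕP.≤-trans t≤n (ℕP.≤-trans (ℕP.m≤m+n n (n ℕ.+ 0)) (ℕP.≤-trans (ℕP.n≤1+n _) (ℕP.m≤m+n _ _))))
  ⊖<0 : ∀ {m k} → m ℕ.< k → m ℤ.⊖ k ℤ.< + 0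
  ⊖<0 {m} {k} m<k rewrite ℤP.⊖-< m<k with k ℕ.∸ m | ℕP.m>n⇒m∸n≢0 m<k
  ... | suc _ | _     = ℤ.-<+
  ... | zero  | k∸m≢0 = ⊥-elim (k∸m≢0 refl)

Increasing⇒positive : ∀ {n} (w : Fin n → ℤ) → Increasing w → ∀ k → + 0 ℤ.< w k
Increasing⇒positive {n} w (0<w₁ , ascending) k =
  subst (λ t → + 0 ℤ.< w t) (FinP.fromℕ<-toℕ k (FinP.toℕ<n k)) (positive-at (toℕ k) (FinP.toℕ<n k))
  where
  positive-at : ∀ m (m<n : m ℕ.< n) → + 0 ℤ.< w (Fin.fromℕ< m<n)
  positive-at zero    m<n = 0<w₁ _ (FinP.toℕ-fromℕ< m<n)
  positive-at (suc m) m<n = ℤP.<-trans (positive-at m (ℕP.<-trans (ℕP.n<1+n m) m<n))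
    (ascending _ _ (trans (cong suc (FinP.toℕ-fromℕ< _)) (sym (FinP.toℕ-fromℕ< m<n))))

levelSum-tabulate : ∀ {n} (c σ : Fin n → ℤ) → (∀ k → + 0 ℤ.≤ c k) → + levelSum (tabulate (λ k → (c k , σ k))) ≡ sumℤ c
levelSum-tabulate {zero}  c σ _     = refl
levelSum-tabulate {suc n} c σ 0≤c =
  cong₂ _+_ (ℤP.0≤i⇒+∣i∣≡i (0≤c Fin.zero)) (levelSum-tabulate (c ∘ Fin.suc) (σ ∘ Fin.suc) (0≤c ∘ Fin.suc))

countFin-<ᵇ-≤ : ∀ {n} m (p : Fin n → Bool) → countFin (λ j → (toℕ j ℕ.<ᵇ m) ∧ p j) ℕ.≤ m
countFin-<ᵇ-≤ {zero}  m       p = ℕ.z≤n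
countFin-<ᵇ-≤ {suc n} zero    p = countFin-<ᵇ-≤ {n} zero (p ∘ Fin.suc)
countFin-<ᵇ-≤ {suc n} (suc m) p with p Fin.zero
... | true  = ℕ.s≤s (countFin-<ᵇ-≤ m (p ∘ Fin.suc))
... | false = ℕP.m≤n⇒m≤1+n (countFin-<ᵇ-≤ m (p ∘ Fin.suc))

Ψ-bounded : ∀ {n} (σ : Fin n → ℤ) k → ∃[ e ] Ψ σ k ≡ + e × e ℕ.< 2 ℕ.* suc (toℕ k)
Ψ-bounded σ k = bounded (isPos (σ k)) (countFin-<ᵇ-≤ (toℕ k) (λ j → ∣ σ k ∣ ℕ.<ᵇ ∣ σ j ∣))
  where
  K = toℕ k
  bounded : ∀ b → eStar σ k ℕ.≤ K →
    ∃[ e ] (if b then + eStar σ k else + suc (2 ℕ.* K) - + eStar σ k) ≡ + e × e ℕ.< 2 ℕ.* suc K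
  bounded true  e*≤K = eStar σ k , refl , ℕP.≤-trans (ℕ.s≤s e*≤K) (ℕP.m≤m+n (suc K) _)
  bounded false e*≤K =
    suc (2 ℕ.* K) ℕ.∸ eStar σ k ,
    sym (+[m∸k]≡+m-+k (ℕP.≤-trans e*≤K (ℕP.≤-trans (ℕP.m≤m+n K _) (ℕP.n≤1+n _)))) ,
    ℕP.≤-trans (ℕ.s≤s (ℕP.m∸n≤m (suc (2 ℕ.* K)) (eStar σ k))) (ℕP.≤-reflexive (cong suc (sym (ℕP.+-suc K (K ℕ.+ 0)))))

ceilDiv-exact : ∀ d .{{_ : ℕ.NonZero d}} c e → e ℕ.< d → ceilDiv (+ d * c - + e) d ≡ c
ceilDiv-exact d c e e<d = begin
  - ((- (+ d * c - + e)) /ℕ d)   ≡⟨ cong (λ t → - (t /ℕ d)) (regroup (+ d) c (+ e)) ⟩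
  - ((+ e + (- c) * + d) /ℕ d)   ≡⟨ cong -_ (proj₁ (divMod-of d (- c) e e<d)) ⟩
  - - c                          ≡⟨ ℤP.neg-involutive c ⟩
  c                              ∎
  where
  open ≡-Reasoning
  regroup : ∀ D c E → - (D * c - E) ≡ E + (- c) * D
  regroup = solve-∀

sumℤ-cong : ∀ {n} {f g : Fin n → ℤ} → (∀ k → f k ≡ g k) → sumℤ f ≡ sumℤ g
sumℤ-cong {zero}  _   = refl
sumℤ-cong {suc n} f≗g = cong₂ _+_ (f≗g Fin.zero) (sumℤ-cong (f≗g ∘ Fin.suc))

level≡ceiling : ∀ {n} (c σ : Fin n → ℤ) k →
  c k ≡ ceilDiv (+ (2 ℕ.* suc (toℕ k)) * c k - Ψ σ k) (2 ℕ.* suc (toℕ k))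
level≡ceiling c σ k with Ψ-bounded σ k
... | e , Ψ≡e , e<2i = sym (trans (cong (λ t → ceilDiv (+ (2 ℕ.* suc (toℕ k)) * c k - t) (2 ℕ.* suc (toℕ k))) Ψ≡e)
                                  (ceilDiv-exact (2 ℕ.* suc (toℕ k)) (c k) e e<2i))

mainTheorem15 : (n : ℕ) (w : Fin n → ℤ)
    → InAffC w
    → Increasing w
    → (c σ : Fin n → ℤ)
    → ((k : Fin n) → w k ≡ c k * + Nmod n + σ k)
    → ((k : Fin n) → 1 ℕ.≤ ∣ σ k ∣ × ∣ σ k ∣ ℕ.≤ n)
    → Injective _≡_ _≡_ (λ k → ∣ σ k ∣)
    → let λ' : Fin n → ℤ
          λ' k = + (2 ℕ.* suc (toℕ k)) * c k - Ψ σ k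
      in (∃[ ρ ] Reduced ρ w)
         × ((ρ : List (Fin (suc n))) → Reduced ρ w → + countSn ρ ≡ sumℤ c)
         × (sumℤ c ≡ sumℤ (λ k → ceilDiv (λ' k) (2 ℕ.* suc (toℕ k))))
mainTheorem15 n w _ increasing c σ w≡ bounded σ-injective =
  (ρ₀ , reduced₀) , countSn-reduced , sumℤ-cong (level≡ceiling c σ)
  where
  W = tabulate (λ k → (c k , σ k))
  shortest = word-reaching n (inversions W) W (Valid-window w≡ bounded σ-injective) refl
  ρ₀ = proj₁ shortest
  ∣ρ₀∣≡ℓ = proj₂ (proj₂ shortest)
  reduced₀ : Reduced ρ₀ w
  reduced₀ = reaches⇒represents w≡ bounded σ-injective ρ₀ (proj₁ (proj₂ shortest)) ,
             λ ρ represents → subst (ℕ._≤ length ρ) (sym ∣ρ₀∣≡ℓ)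
                                    (inversions≤length n ρ (represents⇒reaches w≡ bounded σ-injective ρ represents))
  c≥0 : ∀ k → + 0 ℤ.≤ c k
  c≥0 k = level≥0-of-positive n (c k) (σ k) (proj₂ (bounded k)) (subst (+ 0 ℤ.<_) (w≡ k) (Increasing⇒positive w increasing k))
  countSn-reduced : (ρ : List (Fin (suc n))) → Reduced ρ w → + countSn ρ ≡ sumℤ c
  countSn-reduced ρ (represents , minimal) =
    trans (cong +_ (countSn-shortest n ρ (represents⇒reaches w≡ bounded σ-injective ρ represents)
                                     (subst (length ρ ℕ.≤_) ∣ρ₀∣≡ℓ (minimal ρ₀ (proj₁ reduced₀)))))
          (levelSum-tabulate c σ c≥0)
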